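{- Let $B$ be a subprimitive subset of a finite vector space $V$ over $\mathbb{F}_3$ which is not contained in a hyperplane. If $|B|>\frac16(|V|+3^{k-1})$ for some positive integer $k$, then there exists a $k$-dimensional affine subspace $E$ of $V$ such that $|B\cap E|\ge \frac16(5|E|+3)$.
   Context: A set is subprimitive if it is a subset of a primitive subset of $V$. A hyperplane is an affine subspace of codimension $1$. For an affine subspace $U$, $[U]=U-U$, $\dim U=\dim[U]$; for $U\subseteq H$, $\dim(H/U)=\dim H-\dim U$; $C(U)$ is the linear span of $U$; $\mathrm{aff}$ is the affine hull. For affine subspaces $U\subseteq H$, $W\subseteq H$ is an $(H,U)$-half if $W+[U]=W$ and $H$ is the disjoint union of $U$, $W$ and $(-U)+(-W)$. Primitive sets (recursively on $\dim V$): $A\subseteq V$ is primitive if either (a) $A$ is a hyperplane not containing $0$, or (b) there exist a hyperplane $H$ with $0\notin H$, a proper affine subspace $U\subsetneq H$, an $(H,U)$-half $W$, and a primitive subset $X$ of $C(U)$ with (i) $A=W\cup X$, (ii) $X\cap[U]=\emptyset$, (iii) $\dim(H/U)\ge2$ or $X\ne -U$, (iv) $\mathrm{aff}(X\cap(-U))=-U$. -}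

module Defs where

open import Data.Nat using (ℕ; zero; suc; _+_; _*_; _≤_)
open import Data.Fin using (Fin) renaming (zero to f0; suc to fs)
open import Data.Vec using (Vec; []; _∷_; zipWith; map; replicate)
open import Data.Vec.Relation.Unary.All using (All)
open import Data.List using (List; [_]; concatMap; length; filterᵇ; allFin)
import Data.List as L
open import Data.Bool using (Bool; true; false; _∧_)
open import Data.Product using (Σ; ∃; _×_; _,_)
open import Data.Sum using (_⊎_)
open import Data.Empty using (⊥)
open import Data.Unit using (⊤)
open import Relation.Nullary using (¬_)
open import Relation.Binary.PropositionalEquality using (_≡_)

F3 : Set
F3 = Fin 3

pattern 𝟎 = f0
pattern 𝟏 = fs f0
pattern 𝟐 = fs (fs f0)

_⊕_ : F3 → F3 → F3
𝟎 ⊕ b = b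
𝟏 ⊕ 𝟎 = 𝟏
𝟏 ⊕ 𝟏 = 𝟐
𝟏 ⊕ 𝟐 = 𝟎
𝟐 ⊕ 𝟎 = 𝟐
𝟐 ⊕ 𝟏 = 𝟎
𝟐 ⊕ 𝟐 = 𝟏

⊖_ : F3 → F3
⊖ 𝟎 = 𝟎
⊖ 𝟏 = 𝟐
⊖ 𝟐 = 𝟏

_⊗_ : F3 → F3 → F3
𝟎 ⊗ b = 𝟎
𝟏 ⊗ b = b
𝟐 ⊗ b = ⊖ b

V : ℕ → Set
V n = Vec F3 n

0ᵥ : ∀ {n} → V n
0ᵥ = replicate _ 𝟎

_+ᵥ_ : ∀ {n} → V n → V n → V n
_+ᵥ_ = zipWith _⊕_

-ᵥ_ : ∀ {n} → V n → V n
-ᵥ_ = map ⊖_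

_-ᵥ_ : ∀ {n} → V n → V n → V n
x -ᵥ y = x +ᵥ (-ᵥ y)

_·ᵥ_ : ∀ {n} → F3 → V n → V n
c ·ᵥ v = map (c ⊗_) v

lc : ∀ {n k} → Vec F3 k → Vec (V n) k → V n
lc [] [] = 0ᵥ
lc (c ∷ cs) (v ∷ vs) = (c ·ᵥ v) +ᵥ lc cs vs

sumF : ∀ {k} → Vec F3 k → F3
sumF [] = 𝟎
sumF (c ∷ cs) = c ⊕ sumF cs

LinIndep : ∀ {n k} → Vec (V n) k → Set
LinIndep {k = k} vs = ∀ cs → lc cs vs ≡ 0ᵥ → cs ≡ replicate k 𝟎

Pred : ℕ → Set₁
Pred n = V n → Set

_iff_ : Set → Set → Set
P iff Q = (P → Q) × (Q → P)

_⊆_ : ∀ {n} → Pred n → Pred n → Set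
P ⊆ Q = ∀ x → P x → Q x

_≐_ : ∀ {n} → Pred n → Pred n → Set
P ≐ Q = ∀ x → P x iff Q x

_∩_ : ∀ {n} → Pred n → Pred n → Pred n
(P ∩ Q) x = P x × Q x

Full : ∀ {n} → Pred n
Full _ = ⊤

Neg : ∀ {n} → Pred n → Pred n
Neg U x = U (-ᵥ x)

Diff : ∀ {n} → Pred n → Pred n
Diff U d = Σ _ λ u → Σ _ λ u' → U u × U u' × d ≡ u -ᵥ u'

SumSet : ∀ {n} → Pred n → Pred n → Pred n
SumSet P Q x = Σ _ λ p → Σ _ λ q → P p × Q q × x ≡ p +ᵥ q

Span : ∀ {n} → Pred n → Pred n
Span U x = Σ ℕ λ k → Σ (Vec F3 k) λ cs → Σ (Vec (V _) k) λ vs →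
           All U vs × x ≡ lc cs vs

AffHull : ∀ {n} → Pred n → Pred n
AffHull Y x = Σ ℕ λ k → Σ (Vec F3 k) λ cs → Σ (Vec (V _) k) λ vs →
              All Y vs × sumF cs ≡ 𝟏 × x ≡ lc cs vs

AffDim : ∀ {n} → ℕ → Pred n → Set
AffDim {n} d P = Σ (V n) λ p → Σ (Vec (V n) d) λ vs → LinIndep vs ×
                 (∀ x → P x iff (Σ (Vec F3 d) λ cs → x ≡ p +ᵥ lc cs vs))

LinDim : ∀ {n} → ℕ → Pred n → Set
LinDim d S = AffDim d S × S 0ᵥ

IsHalf : ∀ {n} → Pred n → Pred n → Pred n → Set
IsHalf H U W =
  W ⊆ H ×
  SumSet W (Diff U) ≐ W ×
  (∀ x → H x iff (U x ⊎ (W x ⊎ SumSet (Neg U) (Neg W) x))) ×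
  (∀ x → U x → W x → ⊥) ×
  (∀ x → U x → SumSet (Neg U) (Neg W) x → ⊥) ×
  (∀ x → W x → SumSet (Neg U) (Neg W) x → ⊥)

-- Primitive subsets of a linear subspace S of V (S is the ambient space).
-- Inductive; the recursion goes into C(U), which has smaller dimension.

data Primitive {n} (S : Pred n) : Pred n → Set₁ where
  hyp : ∀ {A d} → LinDim (suc d) S → AffDim d A → A ⊆ S → ¬ A 0ᵥ →
        Primitive S A
  build : ∀ {A H U W X d e} →
          LinDim (suc d) S →
          AffDim d H → H ⊆ S → ¬ H 0ᵥ →
          AffDim e U → U ⊆ H → (Σ _ λ h → H h × ¬ U h) →
          IsHalf H U W →
          Primitive (Span U) X →
          A ≐ (λ x → W x ⊎ X x) →
          (∀ x → X x → Diff U x → ⊥) →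
          ((2 + e ≤ d) ⊎ ¬ (X ≐ Neg U)) →
          AffHull (X ∩ Neg U) ≐ Neg U →
          Primitive S A

Subprimitive : ∀ {n} → Pred n → Set₁
Subprimitive {n} B = Σ (Pred n) λ A → Primitive Full A × B ⊆ A

⟦_⟧ : ∀ {n} → (V n → Bool) → Pred n
⟦ B ⟧ x = B x ≡ true

allV : (n : ℕ) → List (V n)
allV zero = [ [] ]
allV (suc n) = concatMap (λ a → L.map (a ∷_) (allV n)) (allFin 3)

card : ∀ {n} → (V n → Bool) → ℕ
card {n} B = length (filterᵇ B (allV n))

-- Write the primitive set containing B as A = W ∪ X, where W is an (H,U)-half of a hyperplane H
-- and X ⊆ C(U) is primitive (A cannot be a hyperplane, as B spans V).  Counting gives
-- |H| = |U| + 2|W|, |X| ≤ |U|, and |X| ≤ 2|U|/3 when U has codimension 1 in H; with the lower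
-- bound on |B| this leaves fewer than |W|/6 points of W outside B.  Since W + [U] = W, for
-- k ≤ dim U every translate x + L (x ∈ W) of a k-dimensional subspace L ⊆ [U] lies in W, and
-- averaging the number of points outside B over these translates gives a dense one.  Otherwise
-- k = dim U + 1 and U has codimension at least 2 in H; then some flat o + ⟨t⟩ + [U] lies inside
-- W (the line o + ⟨t⟩ is found in a plane through p ∈ U, using that a point reflection exchanges
-- W and -U-W), and it is dense.

module Submission where

open import Defs
open import Data.Nat using (ℕ; zero; suc; _+_; _*_; _^_; _∸_; _≤_; _<_; z≤n; s≤s; s≤s⁻¹; _≤?_; _<?_)
open import Data.Nat.Properties
open import Algebra.Properties.CommutativeSemigroup +-commutativeSemigroup using () renaming (interchange to +-interchange)
open import Data.Nat.Tactic.RingSolver using (solve-∀)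
open import Data.Fin using (Fin) renaming (zero to fzero; suc to fsuc)
import Data.Fin.Properties as Fin
open import Data.Vec using (Vec; []; _∷_; lookup; head; tail; map; replicate; _++_; take)
import Data.Vec.Properties as Vec
open import Data.Vec.Relation.Unary.All using (All; []; _∷_)
open import Data.List using (List; length; filterᵇ)
open import Data.Nat.ListAction using (sum)
open import Data.Nat.ListAction.Properties using (sum-++)
import Data.List as List
import Data.List.Properties as List
open import Data.Bool using (Bool; true; false; _∧_; not)
import Data.Bool as Bool
open import Data.Product using (Σ; _×_; _,_; proj₁; proj₂)
open import Data.Sum using (_⊎_; inj₁; inj₂; [_,_]′)
open import Data.Empty using (⊥; ⊥-elim)
open import Data.Unit using (tt)
open import Function using (_∘_)
open import Relation.Nullary using (¬_; Dec; yes; no; does)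
open import Relation.Nullary.Decidable using (True; toWitness; map′; _×-dec_; _⊎-dec_; ¬?; dec-true)
open import Relation.Binary.PropositionalEquality
  using (_≡_; _≢_; refl; sym; trans; cong; cong₂; subst; subst₂; module ≡-Reasoning)

-- Identities of F₃-vectors, checked coordinatewise: a linear expression is interpreted both in
-- V n and in F₃, and an identity holding in F₃ (decided by evaluation) holds in every V n.

infixl 6 _⊕ₛ_ _⊕ₜ_ _⊖ₜ_
infixl 7 _⊗ₛ_ _⊗ₜ_
infix 8 ⊖ₛ_ ⊖ₜ_

data Scalar (j : ℕ) : Set where
  svar : Fin j → Scalar j
  const : F3 → Scalar j
  _⊕ₛ_ _⊗ₛ_ : Scalar j → Scalar j → Scalar j
  ⊖ₛ_ : Scalar j → Scalar j

data Term (j k : ℕ) : Set where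
  var : Fin k → Term j k
  0ₜ : Term j k
  _⊕ₜ_ : Term j k → Term j k → Term j k
  ⊖ₜ_ : Term j k → Term j k
  _⊗ₜ_ : Scalar j → Term j k → Term j k

_⊖ₜ_ : ∀ {j k} → Term j k → Term j k → Term j k
s ⊖ₜ t = s ⊕ₜ ⊖ₜ t

pattern σ₀ = svar fzero
pattern σ₁ = svar (fsuc fzero)
pattern σ₂ = svar (fsuc (fsuc fzero))
pattern σ₃ = svar (fsuc (fsuc (fsuc fzero)))
pattern x₀ = var fzero
pattern x₁ = var (fsuc fzero)
pattern x₂ = var (fsuc (fsuc fzero))
pattern x₃ = var (fsuc (fsuc (fsuc fzero)))

⟦_⟧ₛ : ∀ {j} → Scalar j → Vec F3 j → F3
⟦ svar i ⟧ₛ σ = lookup σ i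
⟦ const c ⟧ₛ σ = c
⟦ a ⊕ₛ b ⟧ₛ σ = ⟦ a ⟧ₛ σ ⊕ ⟦ b ⟧ₛ σ
⟦ a ⊗ₛ b ⟧ₛ σ = ⟦ a ⟧ₛ σ ⊗ ⟦ b ⟧ₛ σ
⟦ ⊖ₛ a ⟧ₛ σ = ⊖ ⟦ a ⟧ₛ σ

⟦_⟧ᵥ : ∀ {j k n} → Term j k → Vec F3 j → Vec (V n) k → V n
⟦ var i ⟧ᵥ σ ρ = lookup ρ i
⟦ 0ₜ ⟧ᵥ σ ρ = 0ᵥ
⟦ s ⊕ₜ t ⟧ᵥ σ ρ = ⟦ s ⟧ᵥ σ ρ +ᵥ ⟦ t ⟧ᵥ σ ρ
⟦ ⊖ₜ t ⟧ᵥ σ ρ = -ᵥ ⟦ t ⟧ᵥ σ ρ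
⟦ a ⊗ₜ t ⟧ᵥ σ ρ = ⟦ a ⟧ₛ σ ·ᵥ ⟦ t ⟧ᵥ σ ρ

⟦_⟧₁ : ∀ {j k} → Term j k → Vec F3 j → Vec F3 k → F3
⟦ var i ⟧₁ σ ρ = lookup ρ i
⟦ 0ₜ ⟧₁ σ ρ = 𝟎
⟦ s ⊕ₜ t ⟧₁ σ ρ = ⟦ s ⟧₁ σ ρ ⊕ ⟦ t ⟧₁ σ ρ
⟦ ⊖ₜ t ⟧₁ σ ρ = ⊖ ⟦ t ⟧₁ σ ρ
⟦ a ⊗ₜ t ⟧₁ σ ρ = ⟦ a ⟧ₛ σ ⊗ ⟦ t ⟧₁ σ ρ

head∷tail : ∀ {A : Set} {n} (v : Vec A (suc n)) → v ≡ head v ∷ tail v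
head∷tail (x ∷ xs) = refl

⟦⟧ᵥ-∷ : ∀ {j k n} (t : Term j k) σ (ρ : Vec (V (suc n)) k) →
        ⟦ t ⟧ᵥ σ ρ ≡ ⟦ t ⟧₁ σ (map head ρ) ∷ ⟦ t ⟧ᵥ σ (map tail ρ)
⟦⟧ᵥ-∷ (var i) σ ρ =
  trans (head∷tail (lookup ρ i)) (sym (cong₂ _∷_ (Vec.lookup-map i head ρ) (Vec.lookup-map i tail ρ)))
⟦⟧ᵥ-∷ 0ₜ σ ρ = refl
⟦⟧ᵥ-∷ (s ⊕ₜ t) σ ρ rewrite ⟦⟧ᵥ-∷ s σ ρ | ⟦⟧ᵥ-∷ t σ ρ = refl
⟦⟧ᵥ-∷ (⊖ₜ t) σ ρ rewrite ⟦⟧ᵥ-∷ t σ ρ = refl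
⟦⟧ᵥ-∷ (a ⊗ₜ t) σ ρ rewrite ⟦⟧ᵥ-∷ t σ ρ = refl

ScalarIdentity : ∀ {j k} → Term j k → Term j k → Set
ScalarIdentity s t = ∀ σ ρ → ⟦ s ⟧₁ σ ρ ≡ ⟦ t ⟧₁ σ ρ

∀-Vec? : ∀ m {P : Vec F3 m → Set} → (∀ ρ → Dec (P ρ)) → Dec (∀ ρ → P ρ)
∀-Vec? zero P? = map′ (λ p → λ { [] → p }) (λ p → p []) (P? [])
∀-Vec? (suc m) P? = map′ (λ p → λ { (c ∷ ρ) → p c ρ }) (λ p c ρ → p (c ∷ ρ))
  (Fin.all? λ c → ∀-Vec? m λ ρ → P? (c ∷ ρ))

scalarIdentity? : ∀ {j k} (s t : Term j k) → Dec (ScalarIdentity s t)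
scalarIdentity? {j} {k} s t = ∀-Vec? j λ σ → ∀-Vec? k λ ρ → ⟦ s ⟧₁ σ ρ Fin.≟ ⟦ t ⟧₁ σ ρ

identity-lift : ∀ {j k} (s t : Term j k) → ScalarIdentity s t →
                ∀ {n} σ (ρ : Vec (V n) k) → ⟦ s ⟧ᵥ σ ρ ≡ ⟦ t ⟧ᵥ σ ρ
identity-lift s t id {zero} σ ρ with ⟦ s ⟧ᵥ σ ρ | ⟦ t ⟧ᵥ σ ρ
... | [] | [] = refl
identity-lift s t id {suc n} σ ρ = begin
  ⟦ s ⟧ᵥ σ ρ
    ≡⟨ ⟦⟧ᵥ-∷ s σ ρ ⟩
  ⟦ s ⟧₁ σ (map head ρ) ∷ ⟦ s ⟧ᵥ σ (map tail ρ)
    ≡⟨ cong₂ _∷_ (id σ (map head ρ)) (identity-lift s t id σ (map tail ρ)) ⟩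
  ⟦ t ⟧₁ σ (map head ρ) ∷ ⟦ t ⟧ᵥ σ (map tail ρ)
    ≡⟨ ⟦⟧ᵥ-∷ t σ ρ ⟨
  ⟦ t ⟧ᵥ σ ρ ∎
  where open ≡-Reasoning

coordinatewise : ∀ {j k} (s t : Term j k) → {True (scalarIdentity? s t)} →
                 ∀ {n} σ (ρ : Vec (V n) k) → ⟦ s ⟧ᵥ σ ρ ≡ ⟦ t ⟧ᵥ σ ρ
coordinatewise s t {id} = identity-lift s t (toWitness id)

+ᵥ-assoc : ∀ {n} (x y z : V n) → (x +ᵥ y) +ᵥ z ≡ x +ᵥ (y +ᵥ z)
+ᵥ-assoc x y z = coordinatewise ((x₀ ⊕ₜ x₁) ⊕ₜ x₂) (x₀ ⊕ₜ (x₁ ⊕ₜ x₂)) [] (x ∷ y ∷ z ∷ [])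

+ᵥ-identityˡ : ∀ {n} (x : V n) → 0ᵥ +ᵥ x ≡ x
+ᵥ-identityˡ x = coordinatewise (0ₜ ⊕ₜ x₀) x₀ [] (x ∷ [])

+ᵥ-identityʳ : ∀ {n} (x : V n) → x +ᵥ 0ᵥ ≡ x
+ᵥ-identityʳ x = coordinatewise (x₀ ⊕ₜ 0ₜ) x₀ [] (x ∷ [])

-ᵥ-inverseʳ : ∀ {n} (x : V n) → x -ᵥ x ≡ 0ᵥ
-ᵥ-inverseʳ x = coordinatewise (x₀ ⊖ₜ x₀) 0ₜ [] (x ∷ [])

-ᵥ-involutive : ∀ {n} (x : V n) → -ᵥ (-ᵥ x) ≡ x
-ᵥ-involutive x = coordinatewise (⊖ₜ ⊖ₜ x₀) x₀ [] (x ∷ [])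

·ᵥ-identityˡ : ∀ {n} (x : V n) → 𝟏 ·ᵥ x ≡ x
·ᵥ-identityˡ x = coordinatewise (const 𝟏 ⊗ₜ x₀) x₀ [] (x ∷ [])

·ᵥ-zeroˡ : ∀ {n} (x : V n) → 𝟎 ·ᵥ x ≡ 0ᵥ
·ᵥ-zeroˡ x = coordinatewise (const 𝟎 ⊗ₜ x₀) 0ₜ [] (x ∷ [])

·ᵥ-zeroʳ : ∀ {n} (c : F3) → c ·ᵥ 0ᵥ {n} ≡ 0ᵥ
·ᵥ-zeroʳ c = coordinatewise (σ₀ ⊗ₜ 0ₜ) 0ₜ (c ∷ []) []

-ᵥ‿+ᵥ-cancelʳ : ∀ {n} (x y : V n) → (x -ᵥ y) +ᵥ y ≡ x
-ᵥ‿+ᵥ-cancelʳ x y = coordinatewise ((x₀ ⊖ₜ x₁) ⊕ₜ x₁) x₀ [] (x ∷ y ∷ [])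

+ᵥ‿-ᵥ-cancelˡ : ∀ {n} (x y : V n) → (x +ᵥ y) -ᵥ x ≡ y
+ᵥ‿-ᵥ-cancelˡ x y = coordinatewise ((x₀ ⊕ₜ x₁) ⊖ₜ x₀) x₁ [] (x ∷ y ∷ [])

+ᵥ-[-ᵥ]-cancel : ∀ {n} (x y : V n) → x +ᵥ (y -ᵥ x) ≡ y
+ᵥ-[-ᵥ]-cancel x y = coordinatewise (x₀ ⊕ₜ (x₁ ⊖ₜ x₀)) x₁ [] (x ∷ y ∷ [])

-ᵥ‿≡0⇒≡ : ∀ {n} (x y : V n) → x -ᵥ y ≡ 0ᵥ → x ≡ y
-ᵥ‿≡0⇒≡ x y e = trans (sym (-ᵥ‿+ᵥ-cancelʳ x y)) (trans (cong (_+ᵥ y) e) (+ᵥ-identityˡ y))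

+ᵥ-cancelˡ : ∀ {n} (p x y : V n) → p +ᵥ x ≡ p +ᵥ y → x ≡ y
+ᵥ-cancelˡ p x y e = trans (sym (+ᵥ‿-ᵥ-cancelˡ p x)) (trans (cong (_-ᵥ p) e) (+ᵥ‿-ᵥ-cancelˡ p y))

_≟ᵥ_ : ∀ {n} (x y : V n) → Dec (x ≡ y)
_≟ᵥ_ = Vec.≡-dec Fin._≟_

lc-zeroˡ : ∀ {n k} (vs : Vec (V n) k) → lc (replicate k 𝟎) vs ≡ 0ᵥ
lc-zeroˡ [] = refl
lc-zeroˡ (v ∷ vs) = trans (cong₂ _+ᵥ_ (·ᵥ-zeroˡ v) (lc-zeroˡ vs)) (+ᵥ-identityˡ 0ᵥ)

lc-+ : ∀ {n k} (cs ds : V k) (vs : Vec (V n) k) → lc (cs +ᵥ ds) vs ≡ lc cs vs +ᵥ lc ds vs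
lc-+ [] [] [] = sym (+ᵥ-identityˡ 0ᵥ)
lc-+ (c ∷ cs) (d ∷ ds) (v ∷ vs) = trans (cong (((c ⊕ d) ·ᵥ v) +ᵥ_) (lc-+ cs ds vs))
  (coordinatewise ((σ₀ ⊕ₛ σ₁) ⊗ₜ x₀ ⊕ₜ (x₁ ⊕ₜ x₂)) ((σ₀ ⊗ₜ x₀ ⊕ₜ x₁) ⊕ₜ (σ₁ ⊗ₜ x₀ ⊕ₜ x₂))
     (c ∷ d ∷ []) (v ∷ lc cs vs ∷ lc ds vs ∷ []))

lc-· : ∀ {n k} (c : F3) (cs : V k) (vs : Vec (V n) k) → lc (c ·ᵥ cs) vs ≡ c ·ᵥ lc cs vs
lc-· c [] [] = sym (·ᵥ-zeroʳ c)
lc-· c (d ∷ ds) (v ∷ vs) = trans (cong (((c ⊗ d) ·ᵥ v) +ᵥ_) (lc-· c ds vs))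
  (coordinatewise ((σ₀ ⊗ₛ σ₁) ⊗ₜ x₀ ⊕ₜ σ₀ ⊗ₜ x₁) (σ₀ ⊗ₜ (σ₁ ⊗ₜ x₀ ⊕ₜ x₁))
     (c ∷ d ∷ []) (v ∷ lc ds vs ∷ []))

lc-neg : ∀ {n k} (cs : V k) (vs : Vec (V n) k) → lc (-ᵥ cs) vs ≡ -ᵥ lc cs vs
lc-neg cs vs = begin
  lc (-ᵥ cs) vs      ≡⟨ cong (λ ds → lc ds vs) (coordinatewise (⊖ₜ x₀) (const 𝟐 ⊗ₜ x₀) [] (cs ∷ [])) ⟩
  lc (𝟐 ·ᵥ cs) vs    ≡⟨ lc-· 𝟐 cs vs ⟩
  𝟐 ·ᵥ lc cs vs      ≡⟨ coordinatewise (const 𝟐 ⊗ₜ x₀) (⊖ₜ x₀) [] (lc cs vs ∷ []) ⟩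
  -ᵥ lc cs vs        ∎
  where open ≡-Reasoning

lc-injective : ∀ {n k} (vs : Vec (V n) k) → LinIndep vs → ∀ cs ds → lc cs vs ≡ lc ds vs → cs ≡ ds
lc-injective vs li cs ds e = -ᵥ‿≡0⇒≡ cs ds (li (cs -ᵥ ds) (begin
  lc (cs -ᵥ ds) vs             ≡⟨ lc-+ cs (-ᵥ ds) vs ⟩
  lc cs vs +ᵥ lc (-ᵥ ds) vs    ≡⟨ cong₂ _+ᵥ_ e (lc-neg ds vs) ⟩
  lc ds vs -ᵥ lc ds vs         ≡⟨ -ᵥ-inverseʳ (lc ds vs) ⟩
  0ᵥ                           ∎))
  where open ≡-Reasoning

-- Counting points of V n

Σᵥ : ∀ n → (V n → ℕ) → ℕ
Σᵥ zero f = f []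
Σᵥ (suc n) f = Σᵥ n (λ x → f (𝟎 ∷ x)) + (Σᵥ n (λ x → f (𝟏 ∷ x)) + Σᵥ n (λ x → f (𝟐 ∷ x)))

Σᵥ-cong : ∀ n {f g : V n → ℕ} → (∀ x → f x ≡ g x) → Σᵥ n f ≡ Σᵥ n g
Σᵥ-cong zero h = h []
Σᵥ-cong (suc n) h =
  cong₂ _+_ (Σᵥ-cong n (λ x → h (𝟎 ∷ x))) (cong₂ _+_ (Σᵥ-cong n (λ x → h (𝟏 ∷ x))) (Σᵥ-cong n (λ x → h (𝟐 ∷ x))))

Σᵥ-mono-≤ : ∀ n {f g : V n → ℕ} → (∀ x → f x ≤ g x) → Σᵥ n f ≤ Σᵥ n g
Σᵥ-mono-≤ zero h = h []
Σᵥ-mono-≤ (suc n) h =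
  +-mono-≤ (Σᵥ-mono-≤ n (λ x → h (𝟎 ∷ x))) (+-mono-≤ (Σᵥ-mono-≤ n (λ x → h (𝟏 ∷ x))) (Σᵥ-mono-≤ n (λ x → h (𝟐 ∷ x))))

Σᵥ-distrib-+ : ∀ n (f g : V n → ℕ) → Σᵥ n (λ x → f x + g x) ≡ Σᵥ n f + Σᵥ n g
Σᵥ-distrib-+ zero f g = refl
Σᵥ-distrib-+ (suc n) f g
  rewrite Σᵥ-distrib-+ n (λ x → f (𝟎 ∷ x)) (λ x → g (𝟎 ∷ x))
        | Σᵥ-distrib-+ n (λ x → f (𝟏 ∷ x)) (λ x → g (𝟏 ∷ x))
        | Σᵥ-distrib-+ n (λ x → f (𝟐 ∷ x)) (λ x → g (𝟐 ∷ x)) =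
  trans (cong (A₀ + B₀ +_) (+-interchange A₁ B₁ A₂ B₂)) (+-interchange A₀ B₀ (A₁ + A₂) (B₁ + B₂))
  where
  A₀ A₁ A₂ B₀ B₁ B₂ : ℕ
  A₀ = Σᵥ n (λ x → f (𝟎 ∷ x)); A₁ = Σᵥ n (λ x → f (𝟏 ∷ x)); A₂ = Σᵥ n (λ x → f (𝟐 ∷ x))
  B₀ = Σᵥ n (λ x → g (𝟎 ∷ x)); B₁ = Σᵥ n (λ x → g (𝟏 ∷ x)); B₂ = Σᵥ n (λ x → g (𝟐 ∷ x))

Σᵥ-distribˡ-* : ∀ n c (f : V n → ℕ) → Σᵥ n (λ x → c * f x) ≡ c * Σᵥ n f
Σᵥ-distribˡ-* zero c f = refl
Σᵥ-distribˡ-* (suc n) c f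
  rewrite Σᵥ-distribˡ-* n c (λ x → f (𝟎 ∷ x))
        | Σᵥ-distribˡ-* n c (λ x → f (𝟏 ∷ x))
        | Σᵥ-distribˡ-* n c (λ x → f (𝟐 ∷ x)) =
  sym (trans (*-distribˡ-+ c A₀ (A₁ + A₂)) (cong (c * A₀ +_) (*-distribˡ-+ c A₁ A₂)))
  where
  A₀ A₁ A₂ : ℕ
  A₀ = Σᵥ n (λ x → f (𝟎 ∷ x)); A₁ = Σᵥ n (λ x → f (𝟏 ∷ x)); A₂ = Σᵥ n (λ x → f (𝟐 ∷ x))

Σᵥ-const : ∀ n c → Σᵥ n (λ _ → c) ≡ 3 ^ n * c
Σᵥ-const zero c = sym (+-identityʳ c)
Σᵥ-const (suc n) c rewrite Σᵥ-const n c = thrice (3 ^ n) c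
  where
  thrice : ∀ a c → a * c + (a * c + a * c) ≡ (a + (a + (a + 0))) * c
  thrice = solve-∀

Σᵥ-zero : ∀ n {f : V n → ℕ} → (∀ x → f x ≡ 0) → Σᵥ n f ≡ 0
Σᵥ-zero n h = trans (Σᵥ-cong n h) (trans (Σᵥ-const n 0) (*-zeroʳ (3 ^ n)))

Σᵥ-comm : ∀ n m (f : V n → V m → ℕ) → Σᵥ n (λ x → Σᵥ m (f x)) ≡ Σᵥ m (λ y → Σᵥ n (λ x → f x y))
Σᵥ-comm zero m f = refl
Σᵥ-comm (suc n) m f
  rewrite Σᵥ-comm n m (λ x → f (𝟎 ∷ x)) | Σᵥ-comm n m (λ x → f (𝟏 ∷ x)) | Σᵥ-comm n m (λ x → f (𝟐 ∷ x)) =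
  sym (trans (Σᵥ-distrib-+ m _ _) (cong (Σᵥ m (λ y → Σᵥ n (λ x → f (𝟎 ∷ x) y)) +_) (Σᵥ-distrib-+ m _ _)))

Σᵥ-point : ∀ n {f : V n → ℕ} (z : V n) → (∀ x → x ≢ z → f x ≡ 0) → Σᵥ n f ≡ f z
Σᵥ-point zero [] h = refl
Σᵥ-point (suc n) (𝟎 ∷ z) h
  rewrite Σᵥ-point n z (λ x x≢z → h (𝟎 ∷ x) (x≢z ∘ Vec.∷-injectiveʳ))
        | Σᵥ-zero n (λ x → h (𝟏 ∷ x) λ ()) | Σᵥ-zero n (λ x → h (𝟐 ∷ x) λ ()) = +-identityʳ _
Σᵥ-point (suc n) (𝟏 ∷ z) h
  rewrite Σᵥ-point n z (λ x x≢z → h (𝟏 ∷ x) (x≢z ∘ Vec.∷-injectiveʳ))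
        | Σᵥ-zero n (λ x → h (𝟎 ∷ x) λ ()) | Σᵥ-zero n (λ x → h (𝟐 ∷ x) λ ()) = +-identityʳ _
Σᵥ-point (suc n) (𝟐 ∷ z) h
  rewrite Σᵥ-point n z (λ x x≢z → h (𝟐 ∷ x) (x≢z ∘ Vec.∷-injectiveʳ))
        | Σᵥ-zero n (λ x → h (𝟎 ∷ x) λ ()) | Σᵥ-zero n (λ x → h (𝟏 ∷ x) λ ()) = refl

χ : Bool → ℕ
χ true = 1
χ false = 0

#_ : ∀ {n} {P : Pred n} → (∀ x → Dec (P x)) → ℕ
#_ {n} P? = Σᵥ n (λ x → χ (does (P? x)))

χ-does≤1 : ∀ {P : Set} (P? : Dec P) → χ (does P?) ≤ 1
χ-does≤1 (yes _) = s≤s z≤n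
χ-does≤1 (no _) = z≤n

χ-yes : ∀ {P : Set} → P → (P? : Dec P) → χ (does P?) ≡ 1
χ-yes p (yes _) = refl
χ-yes p (no ¬p) = ⊥-elim (¬p p)

χ-no : ∀ {P : Set} → ¬ P → (P? : Dec P) → χ (does P?) ≡ 0
χ-no ¬p (yes p) = ⊥-elim (¬p p)
χ-no ¬p (no _) = refl

χ-mono : ∀ {P Q : Set} → (P → Q) → (P? : Dec P) (Q? : Dec Q) → χ (does P?) ≤ χ (does Q?)
χ-mono f (yes p) Q? = ≤-reflexive (sym (χ-yes (f p) Q?))
χ-mono f (no _) Q? = z≤n

χ-∪ : ∀ {P Q R : Set} → (P → Q ⊎ R) → (P? : Dec P) (Q? : Dec Q) (R? : Dec R) →
      χ (does P?) ≤ χ (does Q?) + χ (does R?)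
χ-∪ f (no _) Q? R? = z≤n
χ-∪ f (yes p) Q? R? with f p
... | inj₁ q = subst (_≤ χ (does Q?) + χ (does R?)) (χ-yes q Q?) (m≤m+n _ _)
... | inj₂ r = subst (_≤ χ (does Q?) + χ (does R?)) (χ-yes r R?) (m≤n+m _ _)

χ-⊎ : ∀ {P Q R : Set} → (P → Q ⊎ R) → (Q ⊎ R → P) → (Q → ¬ R) → (P? : Dec P) (Q? : Dec Q) (R? : Dec R) →
      χ (does P?) ≡ χ (does Q?) + χ (does R?)
χ-⊎ f g q→¬r (no ¬p) Q? R? = sym (cong₂ _+_ (χ-no (¬p ∘ g ∘ inj₁) Q?) (χ-no (¬p ∘ g ∘ inj₂) R?))
χ-⊎ f g q→¬r (yes p) Q? R? with f p
... | inj₁ q = sym (cong₂ _+_ (χ-yes q Q?) (χ-no (q→¬r q) R?))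
... | inj₂ r = sym (cong₂ _+_ (χ-no (λ q → q→¬r q r) Q?) (χ-yes r R?))

#-singleton : ∀ {n} (z : V n) → # (_≟ᵥ z) ≡ 1
#-singleton {n} z = trans (Σᵥ-point n z (λ x x≢z → χ-no x≢z (x ≟ᵥ z))) (χ-yes refl (z ≟ᵥ z))

module _ {n} {P Q : Pred n} (P? : ∀ x → Dec (P x)) (Q? : ∀ x → Dec (Q x)) where

  #-mono-⊆ : P ⊆ Q → # P? ≤ # Q?
  #-mono-⊆ P⊆Q = Σᵥ-mono-≤ n (λ x → χ-mono (P⊆Q x) (P? x) (Q? x))

  #-cong : P ≐ Q → # P? ≡ # Q?
  #-cong P≐Q = Σᵥ-cong n (λ x → ≤-antisym (χ-mono (proj₁ (P≐Q x)) (P? x) (Q? x)) (χ-mono (proj₂ (P≐Q x)) (Q? x) (P? x)))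

  #-∪ : ∀ {R : Pred n} (R? : ∀ x → Dec (R x)) → (∀ x → P x → Q x ⊎ R x) → # P? ≤ # Q? + # R?
  #-∪ R? P⊆Q∪R = subst (# P? ≤_) (Σᵥ-distrib-+ n _ _) (Σᵥ-mono-≤ n (λ x → χ-∪ (P⊆Q∪R x) (P? x) (Q? x) (R? x)))

  #-⊎ : ∀ {R : Pred n} (R? : ∀ x → Dec (R x)) → P ≐ (λ x → Q x ⊎ R x) → (∀ x → Q x → ¬ R x) → # P? ≡ # Q? + # R?
  #-⊎ R? P≐Q⊎R disjoint =
    trans (Σᵥ-cong n (λ x → χ-⊎ (proj₁ (P≐Q⊎R x)) (proj₂ (P≐Q⊎R x)) (disjoint x) (P? x) (Q? x) (R? x)))
          (Σᵥ-distrib-+ n _ _)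

  #-strict-mono : P ⊆ Q → (z : V n) → Q z → ¬ P z → # P? < # Q?
  #-strict-mono P⊆Q z Qz ¬Pz =
    subst (_≤ # Q?) (trans (Σᵥ-distrib-+ n _ _) (cong (_+ # P?) (#-singleton z))) (Σᵥ-mono-≤ n χ≤)
    where
    χ≤ : ∀ x → χ (does (x ≟ᵥ z)) + χ (does (P? x)) ≤ χ (does (Q? x))
    χ≤ x with x ≟ᵥ z
    ... | yes refl = ≤-reflexive (trans (cong suc (χ-no ¬Pz (P? z))) (sym (χ-yes Qz (Q? z))))
    ... | no _ = χ-mono (P⊆Q x) (P? x) (Q? x)

#-⋃₃ : ∀ {n} {Q : Pred n} (P : F3 → Pred n) (P? : ∀ c x → Dec (P c x)) (Q? : ∀ x → Dec (Q x)) →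
        (∀ x → Q x → Σ F3 λ c → P c x) → # Q? ≤ # P? 𝟎 + (# P? 𝟏 + # P? 𝟐)
#-⋃₃ {n} P P? Q? Q⊆⋃P = subst (# Q? ≤_) (trans (Σᵥ-distrib-+ n _ _) (cong (# P? 𝟎 +_) (Σᵥ-distrib-+ n _ _)))
  (Σᵥ-mono-≤ n χ≤)
  where
  χ≤ : ∀ x → χ (does (Q? x)) ≤ χ (does (P? 𝟎 x)) + (χ (does (P? 𝟏 x)) + χ (does (P? 𝟐 x)))
  χ≤ x with Q? x
  ... | no _ = z≤n
  ... | yes Qx with Q⊆⋃P x Qx
  ... | c , Pcx = ≤-trans (χ-mono (λ _ → Pcx) (yes Qx) (P? c x)) (term≤sum c)
    where
    a : F3 → ℕ
    a c = χ (does (P? c x))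
    term≤sum : ∀ c → a c ≤ a 𝟎 + (a 𝟏 + a 𝟐)
    term≤sum 𝟎 = m≤m+n (a 𝟎) (a 𝟏 + a 𝟐)
    term≤sum 𝟏 = ≤-trans (m≤m+n (a 𝟏) (a 𝟐)) (m≤n+m (a 𝟏 + a 𝟐) (a 𝟎))
    term≤sum 𝟐 = ≤-trans (m≤n+m (a 𝟐) (a 𝟏)) (m≤n+m (a 𝟏 + a 𝟐) (a 𝟎))

Σᵥ-reindex : ∀ n (f : V n → ℕ) (g g⁻¹ : V n → V n) → (∀ x → g⁻¹ (g x) ≡ x) → (∀ y → g (g⁻¹ y) ≡ y) →
             Σᵥ n (λ x → f (g x)) ≡ Σᵥ n f
Σᵥ-reindex n f g g⁻¹ g⁻¹∘g g∘g⁻¹ = begin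
  Σᵥ n (λ x → f (g x))
    ≡⟨ Σᵥ-cong n (λ x → sym (trans (Σᵥ-point n (g x) (off-diagonal x)) (diagonal (g x)))) ⟩
  Σᵥ n (λ x → Σᵥ n (λ y → δ y (g x) * f y))
    ≡⟨ Σᵥ-comm n n _ ⟩
  Σᵥ n (λ y → Σᵥ n (λ x → δ y (g x) * f y))
    ≡⟨ Σᵥ-cong n (λ y → Σᵥ-point n (g⁻¹ y) (off-preimage y)) ⟩
  Σᵥ n (λ y → δ y (g (g⁻¹ y)) * f y)
    ≡⟨ Σᵥ-cong n (λ y → subst (λ z → δ y z * f y ≡ f y) (sym (g∘g⁻¹ y)) (diagonal y)) ⟩
  Σᵥ n f ∎
  where
  open ≡-Reasoning
  δ : V n → V n → ℕ
  δ y z = χ (does (y ≟ᵥ z))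
  diagonal : ∀ y → δ y y * f y ≡ f y
  diagonal y = trans (cong (_* f y) (χ-yes refl (y ≟ᵥ y))) (*-identityˡ (f y))
  off-diagonal : ∀ x y → y ≢ g x → δ y (g x) * f y ≡ 0
  off-diagonal x y y≢gx = cong (_* f y) (χ-no y≢gx (y ≟ᵥ g x))
  off-preimage : ∀ y x → x ≢ g⁻¹ y → δ y (g x) * f y ≡ 0
  off-preimage y x x≢g⁻¹y =
    cong (_* f y) (χ-no (λ y≡gx → x≢g⁻¹y (trans (sym (g⁻¹∘g x)) (cong g⁻¹ (sym y≡gx)))) (y ≟ᵥ g x))

length-filterᵇ : ∀ {A : Set} (B : A → Bool) xs → length (filterᵇ B xs) ≡ sum (List.map (χ ∘ B) xs)
length-filterᵇ B List.[] = refl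
length-filterᵇ B (x List.∷ xs) with B x
... | true = cong suc (length-filterᵇ B xs)
... | false = length-filterᵇ B xs

sum-map-allV : ∀ n (f : V n → ℕ) → sum (List.map f (allV n)) ≡ Σᵥ n f
sum-map-allV zero f = +-identityʳ (f [])
sum-map-allV (suc n) f = begin
  sum (List.map f (block 𝟎 List.++ (block 𝟏 List.++ (block 𝟐 List.++ List.[]))))
    ≡⟨ sum-map-++ (block 𝟎) _ ⟩
  Σblock 𝟎 + sum (List.map f (block 𝟏 List.++ (block 𝟐 List.++ List.[])))
    ≡⟨ cong (Σblock 𝟎 +_) (sum-map-++ (block 𝟏) _) ⟩
  Σblock 𝟎 + (Σblock 𝟏 + sum (List.map f (block 𝟐 List.++ List.[])))
    ≡⟨ cong (λ s → Σblock 𝟎 + (Σblock 𝟏 + s)) (cong (sum ∘ List.map f) (List.++-identityʳ (block 𝟐))) ⟩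
  Σblock 𝟎 + (Σblock 𝟏 + Σblock 𝟐)
    ≡⟨ cong₂ _+_ (Σblock≡ 𝟎) (cong₂ _+_ (Σblock≡ 𝟏) (Σblock≡ 𝟐)) ⟩
  Σᵥ (suc n) f ∎
  where
  open ≡-Reasoning
  block : F3 → List (V (suc n))
  block c = List.map (c ∷_) (allV n)
  Σblock : F3 → ℕ
  Σblock c = sum (List.map f (block c))
  sum-map-++ : ∀ xs ys → sum (List.map f (xs List.++ ys)) ≡ sum (List.map f xs) + sum (List.map f ys)
  sum-map-++ xs ys = trans (cong sum (List.map-++ f xs ys)) (sum-++ (List.map f xs) _)
  Σblock≡ : ∀ c → Σblock c ≡ Σᵥ n (λ x → f (c ∷ x))
  Σblock≡ c = trans (cong sum (sym (List.map-∘ (allV n)))) (sum-map-allV n (λ x → f (c ∷ x)))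

card≡Σᵥ : ∀ {n} (B : V n → Bool) → card B ≡ Σᵥ n (χ ∘ B)
card≡Σᵥ {n} B = trans (length-filterᵇ B (allV n)) (sum-map-allV n (χ ∘ B))

card≡# : ∀ {n} (B : V n → Bool) → card B ≡ # (λ x → B x Bool.≟ true)
card≡# {n} B = trans (card≡Σᵥ B) (Σᵥ-cong n (λ x → χ-≟true (B x)))
  where
  χ-≟true : ∀ b → χ b ≡ χ (does (b Bool.≟ true))
  χ-≟true true = refl
  χ-≟true false = refl

∃-Vec? : ∀ m {P : Vec F3 m → Set} → (∀ ρ → Dec (P ρ)) → Dec (Σ (Vec F3 m) P)
∃-Vec? zero P? = map′ ([] ,_) (λ { ([] , p) → p }) (P? [])
∃-Vec? (suc m) P? = map′ (λ { (c , ρ , p) → c ∷ ρ , p }) (λ { (c ∷ ρ , p) → c , ρ , p })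
  (Fin.any? λ c → ∃-Vec? m λ ρ → P? (c ∷ ρ))

Flat : ∀ {n k} → V n → Vec (V n) k → Pred n
Flat {k = k} p vs x = Σ (V k) λ cs → x ≡ p +ᵥ lc cs vs

Flat? : ∀ {n k} (p : V n) (vs : Vec (V n) k) → ∀ x → Dec (Flat p vs x)
Flat? {k = k} p vs x = ∃-Vec? k λ cs → x ≟ᵥ (p +ᵥ lc cs vs)

#Flat : ∀ {n k} (p : V n) (vs : Vec (V n) k) → LinIndep vs → # Flat? p vs ≡ 3 ^ k
#Flat {n} {k} p vs li = begin
  Σᵥ n (λ x → χ (does (Flat? p vs x)))                 ≡⟨ Σᵥ-cong n χ-Flat ⟩
  Σᵥ n (λ x → Σᵥ k (λ cs → δ x cs))                    ≡⟨ Σᵥ-comm n k _ ⟩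
  Σᵥ k (λ cs → Σᵥ n (λ x → δ x cs))                    ≡⟨ Σᵥ-cong k (λ cs → #-singleton (p +ᵥ lc cs vs)) ⟩
  Σᵥ k (λ _ → 1)                                       ≡⟨ Σᵥ-const k 1 ⟩
  3 ^ k * 1                                            ≡⟨ *-identityʳ (3 ^ k) ⟩
  3 ^ k                                                ∎
  where
  open ≡-Reasoning
  δ : V n → V k → ℕ
  δ x cs = χ (does (x ≟ᵥ (p +ᵥ lc cs vs)))
  χ-Flat : ∀ x → χ (does (Flat? p vs x)) ≡ Σᵥ k (δ x)
  χ-Flat x with Flat? p vs x
  ... | yes (cs , x≡) = sym (trans (Σᵥ-point k cs unique) (χ-yes x≡ (x ≟ᵥ _)))
    where
    unique : ∀ ds → ds ≢ cs → δ x ds ≡ 0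
    unique ds ds≢cs = χ-no (λ x≡′ → ds≢cs (lc-injective vs li ds cs (+ᵥ-cancelˡ p _ _ (trans (sym x≡′) x≡)))) (x ≟ᵥ _)
  ... | no ¬flat = sym (Σᵥ-zero k (λ cs → χ-no (λ x≡ → ¬flat (cs , x≡)) (x ≟ᵥ _)))

AffDim? : ∀ {n k} {P : Pred n} → AffDim k P → ∀ x → Dec (P x)
AffDim? (p , vs , li , P≐Flat) x = map′ (proj₂ (P≐Flat x)) (proj₁ (P≐Flat x)) (Flat? p vs x)

#AffDim : ∀ {n k} {P : Pred n} → AffDim k P → (P? : ∀ x → Dec (P x)) → # P? ≡ 3 ^ k
#AffDim (p , vs , li , P≐Flat) P? = trans (#-cong P? (Flat? p vs) P≐Flat) (#Flat p vs li)

#-⋃₃Flat≤ : ∀ {n e} {Q : Pred n} (base : F3 → V n) (vs : Vec (V n) e) → LinIndep vs → (Q? : ∀ x → Dec (Q x)) →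
            (∀ x → Q x → Σ F3 λ c → Flat (base c) vs x) → # Q? ≤ 3 ^ suc e
#-⋃₃Flat≤ {e = e} base vs li Q? Q⊆⋃ = begin
  # Q?                                                     ≤⟨ #-⋃₃ (λ c → Flat (base c) vs) Flat?ᶜ Q? Q⊆⋃ ⟩
  # Flat?ᶜ 𝟎 + (# Flat?ᶜ 𝟏 + # Flat?ᶜ 𝟐)                   ≡⟨ cong₂ _+_ (#Flat (base 𝟎) vs li) (cong₂ _+_ (#Flat (base 𝟏) vs li)
                                                                (trans (#Flat (base 𝟐) vs li) (sym (+-identityʳ (3 ^ e))))) ⟩
  3 ^ suc e                                                ∎
  where
  open ≤-Reasoning
  Flat?ᶜ : ∀ c x → Dec (Flat (base c) vs x)
  Flat?ᶜ c = Flat? (base c) vs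

3^-reflects-≤ : ∀ a b → 3 ^ a ≤ 3 ^ b → a ≤ b
3^-reflects-≤ a b 3^a≤3^b with a ≤? b
... | yes a≤b = a≤b
... | no a≰b = ⊥-elim (<⇒≱ (^-monoʳ-< 3 (s≤s (s≤s z≤n)) (≰⇒> a≰b)) 3^a≤3^b)

3^-reflects-< : ∀ a b → 3 ^ a < 3 ^ b → a < b
3^-reflects-< a b 3^a<3^b with a <? b
... | yes a<b = a<b
... | no a≮b = ⊥-elim (<⇒≱ 3^a<3^b (^-monoʳ-≤ 3 (≮⇒≥ a≮b)))

3^-injective : ∀ a b → 3 ^ a ≡ 3 ^ b → a ≡ b
3^-injective a b e = ≤-antisym (3^-reflects-≤ a b (≤-reflexive e)) (3^-reflects-≤ b a (≤-reflexive (sym e)))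

AffDim-unique : ∀ {n d d′} {P : Pred n} → AffDim d P → AffDim d′ P → d ≡ d′
AffDim-unique {d = d} {d′} {P} P-d P-d′ = 3^-injective d d′ (trans (sym (#AffDim P-d P?)) (#AffDim P-d′ P?))
  where
  P? : ∀ x → Dec (P x)
  P? = AffDim? P-d

AffDim-mono-⊊ : ∀ {n d e} {P Q : Pred n} → AffDim d P → AffDim e Q → P ⊆ Q → (z : V n) → Q z → ¬ P z → d < e
AffDim-mono-⊊ {d = d} {e} {P} {Q} P-d Q-e P⊆Q z Qz ¬Pz =
  3^-reflects-< d e (subst₂ _<_ (#AffDim P-d P?) (#AffDim Q-e Q?) (#-strict-mono P? Q? P⊆Q z Qz ¬Pz))
  where
  P? : ∀ x → Dec (P x)
  P? = AffDim? P-d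
  Q? : ∀ x → Dec (Q x)
  Q? = AffDim? Q-e

dim-Full : ∀ {n d} → AffDim d (Full {n}) → d ≡ n
dim-Full {n} {d} Full-d = 3^-injective d n (begin
  3 ^ d                        ≡⟨ #AffDim Full-d (λ _ → yes tt) ⟨
  Σᵥ n (λ _ → 1)               ≡⟨ Σᵥ-const n 1 ⟩
  3 ^ n * 1                    ≡⟨ *-identityʳ (3 ^ n) ⟩
  3 ^ n                        ∎)
  where open ≡-Reasoning

-- The cosets of [U] in C(U)

Flat-lincomb : ∀ {n k} (p : V n) (vs : Vec (V n) k) c₁ c₂ s₁ s₂ {y₁ y₂} →
               Flat (s₁ ·ᵥ p) vs y₁ → Flat (s₂ ·ᵥ p) vs y₂ →
               Flat (((c₁ ⊗ s₁) ⊕ (c₂ ⊗ s₂)) ·ᵥ p) vs ((c₁ ·ᵥ y₁) +ᵥ (c₂ ·ᵥ y₂))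
Flat-lincomb p vs c₁ c₂ s₁ s₂ (cs₁ , refl) (cs₂ , refl) = (c₁ ·ᵥ cs₁) +ᵥ (c₂ ·ᵥ cs₂) , (begin
  (c₁ ·ᵥ ((s₁ ·ᵥ p) +ᵥ lc cs₁ vs)) +ᵥ (c₂ ·ᵥ ((s₂ ·ᵥ p) +ᵥ lc cs₂ vs))
    ≡⟨ coordinatewise (σ₀ ⊗ₜ (σ₂ ⊗ₜ x₀ ⊕ₜ x₁) ⊕ₜ σ₁ ⊗ₜ (σ₃ ⊗ₜ x₀ ⊕ₜ x₂))
                      ((σ₀ ⊗ₛ σ₂ ⊕ₛ σ₁ ⊗ₛ σ₃) ⊗ₜ x₀ ⊕ₜ (σ₀ ⊗ₜ x₁ ⊕ₜ σ₁ ⊗ₜ x₂))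
                      (c₁ ∷ c₂ ∷ s₁ ∷ s₂ ∷ []) (p ∷ lc cs₁ vs ∷ lc cs₂ vs ∷ []) ⟩
  (((c₁ ⊗ s₁) ⊕ (c₂ ⊗ s₂)) ·ᵥ p) +ᵥ ((c₁ ·ᵥ lc cs₁ vs) +ᵥ (c₂ ·ᵥ lc cs₂ vs))
    ≡⟨ cong (_ +ᵥ_) (sym (trans (lc-+ (c₁ ·ᵥ cs₁) (c₂ ·ᵥ cs₂) vs) (cong₂ _+ᵥ_ (lc-· c₁ cs₁ vs) (lc-· c₂ cs₂ vs)))) ⟩
  (((c₁ ⊗ s₁) ⊕ (c₂ ⊗ s₂)) ·ᵥ p) +ᵥ lc ((c₁ ·ᵥ cs₁) +ᵥ (c₂ ·ᵥ cs₂)) vs ∎)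
  where open ≡-Reasoning

module Levels {n e} {U : Pred n} (U-e : AffDim e U) where

  p : V n
  p = proj₁ U-e
  vs : Vec (V n) e
  vs = proj₁ (proj₂ U-e)
  li : LinIndep vs
  li = proj₁ (proj₂ (proj₂ U-e))
  U≐Flat : U ≐ Flat p vs
  U≐Flat = proj₂ (proj₂ (proj₂ U-e))

  Level : F3 → Pred n
  Level s = Flat (s ·ᵥ p) vs

  Level? : ∀ s x → Dec (Level s x)
  Level? s = Flat? (s ·ᵥ p) vs

  U⊆Level𝟏 : U ⊆ Level 𝟏
  U⊆Level𝟏 y Uy with proj₁ (U≐Flat y) Uy
  ... | cs , y≡ = cs , trans y≡ (cong (_+ᵥ lc cs vs) (sym (·ᵥ-identityˡ p)))

  Level𝟐⊆-U : Level 𝟐 ⊆ Neg U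
  Level𝟐⊆-U y (cs , refl) = proj₂ (U≐Flat _) (-ᵥ cs , (begin
    -ᵥ ((𝟐 ·ᵥ p) +ᵥ lc cs vs)   ≡⟨ coordinatewise (⊖ₜ (const 𝟐 ⊗ₜ x₀ ⊕ₜ x₁)) (x₀ ⊖ₜ x₁) [] (p ∷ lc cs vs ∷ []) ⟩
    p -ᵥ lc cs vs               ≡⟨ cong (p +ᵥ_) (lc-neg cs vs) ⟨
    p +ᵥ lc (-ᵥ cs) vs          ∎))
    where open ≡-Reasoning

  -U⊆Level𝟐 : Neg U ⊆ Level 𝟐
  -U⊆Level𝟐 y -Uy with proj₁ (U≐Flat (-ᵥ y)) -Uy
  ... | cs , -y≡ = -ᵥ cs , (begin
    y                           ≡⟨ -ᵥ-involutive y ⟨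
    -ᵥ (-ᵥ y)                   ≡⟨ cong -ᵥ_ -y≡ ⟩
    -ᵥ (p +ᵥ lc cs vs)          ≡⟨ coordinatewise (⊖ₜ (x₀ ⊕ₜ x₁)) (const 𝟐 ⊗ₜ x₀ ⊖ₜ x₁) [] (p ∷ lc cs vs ∷ []) ⟩
    (𝟐 ·ᵥ p) -ᵥ lc cs vs        ≡⟨ cong ((𝟐 ·ᵥ p) +ᵥ_) (lc-neg cs vs) ⟨
    (𝟐 ·ᵥ p) +ᵥ lc (-ᵥ cs) vs   ∎)
    where open ≡-Reasoning

  p∈U : U p
  p∈U = proj₂ (U≐Flat p) (replicate e 𝟎 , sym (trans (cong (p +ᵥ_) (lc-zeroˡ vs)) (+ᵥ-identityʳ p)))

  Level𝟎⊆[U] : Level 𝟎 ⊆ Diff U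
  Level𝟎⊆[U] y (cs , refl) = p +ᵥ lc cs vs , p , proj₂ (U≐Flat _) (cs , refl) , p∈U ,
    coordinatewise (const 𝟎 ⊗ₜ x₀ ⊕ₜ x₁) ((x₀ ⊕ₜ x₁) ⊖ₜ x₀) [] (p ∷ lc cs vs ∷ [])

  0∈Level𝟎 : Level 𝟎 0ᵥ
  0∈Level𝟎 = replicate e 𝟎 , sym (trans (cong ((𝟎 ·ᵥ p) +ᵥ_) (lc-zeroˡ vs))
                                       (coordinatewise (const 𝟎 ⊗ₜ x₀ ⊕ₜ 0ₜ) 0ₜ [] (p ∷ [])))

  lc-level : ∀ {k} (cs : V k) (ws : Vec (V n) k) → All U ws → Σ F3 λ s → Level s (lc cs ws)
  lc-level [] [] [] = 𝟎 , 0∈Level𝟎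
  lc-level (c ∷ cs) (w ∷ ws) (Uw ∷ Uws) with lc-level cs ws Uws
  ... | s , in-s = (c ⊗ 𝟏) ⊕ (𝟏 ⊗ s) ,
    subst (Level ((c ⊗ 𝟏) ⊕ (𝟏 ⊗ s))) (cong ((c ·ᵥ w) +ᵥ_) (·ᵥ-identityˡ (lc cs ws)))
      (Flat-lincomb p vs c 𝟏 𝟏 s (U⊆Level𝟏 w Uw) in-s)

  Span⊆Levels : ∀ x → Span U x → Σ F3 λ s → Level s x
  Span⊆Levels x (k , cs , ws , Uws , refl) = lc-level cs ws Uws

  #Span≤ : (Span? : ∀ x → Dec (Span U x)) → # Span? ≤ 3 ^ suc e
  #Span≤ Span? = #-⋃₃Flat≤ (_·ᵥ p) vs li Span? Span⊆Levels

-- Halves and the size of primitive sets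

module Halves {n d e} {H U W : Pred n} (H-d : AffDim d H) (U-e : AffDim e U) (U⊆H : U ⊆ H)
              (U⊊H : Σ (V n) λ h → H h × ¬ U h) (half : IsHalf H U W) where

  open Levels U-e using (p; p∈U)

  -U-W : Pred n
  -U-W = SumSet (Neg U) (Neg W)

  W⊆H : W ⊆ H
  W⊆H = proj₁ half
  W+[U]≐W : SumSet W (Diff U) ≐ W
  W+[U]≐W = proj₁ (proj₂ half)
  H≐U⊎W⊎-U-W : ∀ x → H x iff (U x ⊎ (W x ⊎ -U-W x))
  H≐U⊎W⊎-U-W = proj₁ (proj₂ (proj₂ half))
  U∩W=∅ : ∀ x → U x → ¬ W x
  U∩W=∅ = proj₁ (proj₂ (proj₂ (proj₂ half)))
  U∩-U-W=∅ : ∀ x → U x → ¬ -U-W x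
  U∩-U-W=∅ = proj₁ (proj₂ (proj₂ (proj₂ (proj₂ half))))
  W∩-U-W=∅ : ∀ x → W x → ¬ -U-W x
  W∩-U-W=∅ = proj₂ (proj₂ (proj₂ (proj₂ (proj₂ half))))

  W+[U]⊆W : ∀ a b → W a → Diff U b → W (a +ᵥ b)
  W+[U]⊆W a b Wa [U]b = proj₁ (W+[U]≐W (a +ᵥ b)) (a , b , Wa , [U]b , refl)

  H? : ∀ x → Dec (H x)
  H? = AffDim? H-d

  U? : ∀ x → Dec (U x)
  U? = AffDim? U-e

  W? : ∀ x → Dec (W x)
  W? x with H? x
  ... | no ¬Hx = no (¬Hx ∘ W⊆H x)
  ... | yes Hx with proj₁ (H≐U⊎W⊎-U-W x) Hx
  ... | inj₁ Ux = no (U∩W=∅ x Ux)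
  ... | inj₂ (inj₁ Wx) = yes Wx
  ... | inj₂ (inj₂ -U-Wx) = no (λ Wx → W∩-U-W=∅ x Wx -U-Wx)

  -- x ↦ -p - x is the point reflection in p (as 2 = -1 in F₃); it exchanges W and -U-W.
  reflect : V n → V n
  reflect x = (-ᵥ p) -ᵥ x

  reflect-involutive : ∀ x → reflect (reflect x) ≡ x
  reflect-involutive x = coordinatewise ((⊖ₜ x₀) ⊖ₜ ((⊖ₜ x₀) ⊖ₜ x₁)) x₁ [] (p ∷ x ∷ [])

  -U-W⊆W∘reflect : ∀ x → -U-W x → W (reflect x)
  -U-W⊆W∘reflect x (u , w , -Uu , -Ww , refl) =
    subst W (coordinatewise ((⊖ₜ x₂) ⊕ₜ ((⊖ₜ x₁) ⊖ₜ x₀)) ((⊖ₜ x₀) ⊖ₜ (x₁ ⊕ₜ x₂)) [] (p ∷ u ∷ w ∷ []))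
      (W+[U]⊆W (-ᵥ w) ((-ᵥ u) -ᵥ p) -Ww (-ᵥ u , p , -Uu , p∈U , refl))

  W∘reflect⊆-U-W : ∀ x → W (reflect x) → -U-W x
  W∘reflect⊆-U-W x W-reflect-x =
    -ᵥ p , -ᵥ reflect x , subst U (sym (-ᵥ-involutive p)) p∈U , subst W (sym (-ᵥ-involutive (reflect x))) W-reflect-x ,
    coordinatewise x₁ ((⊖ₜ x₀) ⊕ₜ (⊖ₜ ((⊖ₜ x₀) ⊖ₜ x₁))) [] (p ∷ x ∷ [])

  -U-W? : ∀ x → Dec (-U-W x)
  -U-W? x = map′ (W∘reflect⊆-U-W x) (-U-W⊆W∘reflect x) (W? (reflect x))

  #-U-W≡#W : # -U-W? ≡ # W?
  #-U-W≡#W = trans (Σᵥ-cong n (λ x → χ-W∘reflect x))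
                   (Σᵥ-reindex n (λ x → χ (does (W? x))) reflect reflect reflect-involutive reflect-involutive)
    where
    χ-W∘reflect : ∀ x → χ (does (-U-W? x)) ≡ χ (does (W? (reflect x)))
    χ-W∘reflect x with W? (reflect x)
    ... | yes _ = refl
    ... | no _ = refl

  #H≡ : 3 ^ d ≡ 3 ^ e + (# W? + # W?)
  #H≡ = begin
    3 ^ d                                  ≡⟨ #AffDim H-d H? ⟨
    # H?                                   ≡⟨ #-⊎ H? U? (λ x → W? x ⊎-dec -U-W? x) H≐U⊎W⊎-U-W
                                                 (λ x Ux → [ U∩W=∅ x Ux , U∩-U-W=∅ x Ux ]′) ⟩
    # U? + # (λ x → W? x ⊎-dec -U-W? x)    ≡⟨ cong₂ _+_ (#AffDim U-e U?)
                                                 (#-⊎ (λ x → W? x ⊎-dec -U-W? x) W? -U-W? (λ _ → (λ z → z) , (λ z → z)) W∩-U-W=∅) ⟩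
    3 ^ e + (# W? + # -U-W?)               ≡⟨ cong (λ m → 3 ^ e + (# W? + m)) #-U-W≡#W ⟩
    3 ^ e + (# W? + # W?)                  ∎
    where open ≡-Reasoning

  e<d : e < d
  e<d = AffDim-mono-⊊ U-e H-d U⊆H (proj₁ U⊊H) (proj₁ (proj₂ U⊊H)) (proj₂ (proj₂ U⊊H))

Primitive? : ∀ {n} {S A : Pred n} → Primitive S A → ∀ x → Dec (A x)
Primitive? (hyp _ A-d _ _) = AffDim? A-d
Primitive? (build _ H-d _ _ U-e U⊆H U⊊H half X-prim A≐W∪X _ _ _) x =
  map′ (proj₂ (A≐W∪X x)) (proj₁ (A≐W∪X x)) (W? x ⊎-dec Primitive? X-prim x)
  where open Halves H-d U-e U⊆H U⊊H half using (W?)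

ambientDim : ∀ {n} {S A : Pred n} → Primitive S A → Σ ℕ λ d → LinDim (suc d) S
ambientDim (hyp S-d _ _ _) = _ , S-d
ambientDim (build S-d _ _ _ _ _ _ _ _ _ _ _ _) = _ , S-d

LinDim-unique : ∀ {n d d′} {S : Pred n} → LinDim (suc d) S → LinDim (suc d′) S → d ≡ d′
LinDim-unique S-d S-d′ = suc-injective (AffDim-unique (proj₁ S-d) (proj₁ S-d′))

module _ {n e} {U X : Pred n} (U-e : AffDim e U) (X-prim : Primitive (Span U) X) where

  ambientDim≤ : proj₁ (ambientDim X-prim) ≤ e
  ambientDim≤ = s≤s⁻¹ (3^-reflects-≤ (suc d) (suc e)
    (subst (_≤ 3 ^ suc e) (#AffDim (proj₁ Span-d) Span?) (Levels.#Span≤ U-e Span?)))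
    where
    d : ℕ
    d = proj₁ (ambientDim X-prim)
    Span-d : LinDim (suc d) (Span U)
    Span-d = proj₂ (ambientDim X-prim)
    Span? : ∀ x → Dec (Span U x)
    Span? = AffDim? (proj₁ Span-d)

  #PrimitiveInSpan≤ : (∀ {d} → LinDim (suc d) (Span U) → (X? : ∀ x → Dec (X x)) → # X? ≤ 3 ^ d) →
                      (X? : ∀ x → Dec (X x)) → # X? ≤ 3 ^ e
  #PrimitiveInSpan≤ #X≤ X? = ≤-trans (#X≤ (proj₂ (ambientDim X-prim)) X?) (^-monoʳ-≤ 3 ambientDim≤)

#build≤ : ∀ {n d e} {A H U W X : Pred n} (H-d : AffDim d H) (U-e : AffDim e U) (U⊆H : U ⊆ H)
          (U⊊H : Σ (V n) λ h → H h × ¬ U h) → IsHalf H U W →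
          (X? : ∀ x → Dec (X x)) → # X? ≤ 3 ^ e → A ≐ (λ x → W x ⊎ X x) →
          (A? : ∀ x → Dec (A x)) → 2 * # A? ≤ 3 ^ d + 3 ^ e
#build≤ {d = d} {e} H-d U-e U⊆H U⊊H half X? #X≤ A≐W∪X A? = begin
  2 * # A?                      ≤⟨ *-monoʳ-≤ 2 (#-∪ A? W? X? (λ x → proj₁ (A≐W∪X x))) ⟩
  2 * (# W? + # X?)             ≤⟨ *-monoʳ-≤ 2 (+-monoʳ-≤ (# W?) #X≤) ⟩
  2 * (# W? + 3 ^ e)            ≡⟨ regroup (# W?) (3 ^ e) ⟩
  (3 ^ e + (# W? + # W?)) + 3 ^ e ≡⟨ cong (_+ 3 ^ e) #H≡ ⟨
  3 ^ d + 3 ^ e                 ∎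
  where
  open Halves H-d U-e U⊆H U⊊H half using (W?; #H≡)
  open ≤-Reasoning
  regroup : ∀ w E → 2 * (w + E) ≡ (E + (w + w)) + E
  regroup = solve-∀

#Primitive≤ : ∀ {n d} {S A : Pred n} → Primitive S A → LinDim (suc d) S → (A? : ∀ x → Dec (A x)) → # A? ≤ 3 ^ d
#Primitive≤ (hyp S-d′ A-d′ _ _) S-d A? = ≤-reflexive (trans (#AffDim A-d′ A?) (cong (3 ^_) (LinDim-unique S-d′ S-d)))
#Primitive≤ (build {X = X} {d = d′} {e = e} S-d′ H-d _ _ U-e U⊆H U⊊H half X-prim A≐W∪X _ _ _) S-d A? =
  subst (λ m → # A? ≤ 3 ^ m) (LinDim-unique S-d′ S-d) (*-cancelˡ-≤ 2 (begin
    2 * # A?              ≤⟨ #build≤ H-d U-e U⊆H U⊊H half X? #X≤ A≐W∪X A? ⟩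
    3 ^ d′ + 3 ^ e        ≤⟨ +-monoʳ-≤ (3 ^ d′) (^-monoʳ-≤ 3 (<⇒≤ e<d)) ⟩
    3 ^ d′ + 3 ^ d′       ≡⟨ cong (3 ^ d′ +_) (+-identityʳ (3 ^ d′)) ⟨
    2 * 3 ^ d′            ∎))
  where
  open Halves H-d U-e U⊆H U⊊H half using (e<d)
  open ≤-Reasoning
  X? : ∀ x → Dec (X x)
  X? = Primitive? X-prim
  #X≤ : # X? ≤ 3 ^ e
  #X≤ = #PrimitiveInSpan≤ U-e X-prim (#Primitive≤ X-prim) X?

AffHull-nonempty : ∀ {n} {Y : Pred n} {x} → AffHull Y x → Σ (V n) Y
AffHull-nonempty (zero , [] , [] , [] , () , _)
AffHull-nonempty (suc k , c ∷ cs , v ∷ vs , Yv ∷ _ , _) = v , Yv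

Flat-affine₂₂ : ∀ {n k} (q : V n) (ws : Vec (V n) k) {x y} → Flat q ws x → Flat q ws y →
                Flat q ws ((𝟐 ·ᵥ x) +ᵥ (𝟐 ·ᵥ y))
Flat-affine₂₂ q ws (a , refl) (b , refl) = (𝟐 ·ᵥ a) +ᵥ (𝟐 ·ᵥ b) , (begin
  (𝟐 ·ᵥ (q +ᵥ lc a ws)) +ᵥ (𝟐 ·ᵥ (q +ᵥ lc b ws))
    ≡⟨ coordinatewise (const 𝟐 ⊗ₜ (x₀ ⊕ₜ x₁) ⊕ₜ const 𝟐 ⊗ₜ (x₀ ⊕ₜ x₂)) (x₀ ⊕ₜ (const 𝟐 ⊗ₜ x₁ ⊕ₜ const 𝟐 ⊗ₜ x₂))
                      [] (q ∷ lc a ws ∷ lc b ws ∷ []) ⟩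
  q +ᵥ ((𝟐 ·ᵥ lc a ws) +ᵥ (𝟐 ·ᵥ lc b ws))
    ≡⟨ cong (q +ᵥ_) (sym (trans (lc-+ (𝟐 ·ᵥ a) (𝟐 ·ᵥ b) ws) (cong₂ _+ᵥ_ (lc-· 𝟐 a ws) (lc-· 𝟐 b ws)))) ⟩
  q +ᵥ lc ((𝟐 ·ᵥ a) +ᵥ (𝟐 ·ᵥ b)) ws ∎)
  where open ≡-Reasoning

module _ {n e} {U X : Pred n} (U-e : AffDim e U)
         (X∩[U]=∅ : ∀ x → X x → Diff U x → ⊥) (X∩-U-spans : AffHull (X ∩ Neg U) ≐ Neg U) where

  open Levels U-e

  X∩-U-point : Σ (V n) λ q → X q × Level 𝟐 q
  X∩-U-point with AffHull-nonempty (proj₂ (X∩-U-spans (-ᵥ p)) (subst U (sym (-ᵥ-involutive p)) p∈U))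
  ... | q , Xq , -Uq = q , Xq , -U⊆Level𝟐 q -Uq

  -- X is affine and meets level 2 at q₀, so a point x of X on level 1 would give 2x + 2q₀ ∈ X ∩ [U].
  AffineInSpan⊆Level𝟐 : ∀ {d} → AffDim d X → X ⊆ Span U → X ⊆ Level 𝟐
  AffineInSpan⊆Level𝟐 (q , ws , _ , X≐Flat) X⊆Span x Xx with Span⊆Levels x (X⊆Span x Xx)
  ... | 𝟎 , x∈L𝟎 = ⊥-elim (X∩[U]=∅ x Xx (Level𝟎⊆[U] x x∈L𝟎))
  ... | 𝟐 , x∈L𝟐 = x∈L𝟐
  ... | 𝟏 , x∈L𝟏 = ⊥-elim (X∩[U]=∅ y Xy (Level𝟎⊆[U] y (Flat-lincomb p vs 𝟐 𝟐 𝟏 𝟐 x∈L𝟏 q₀∈L𝟐)))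
    where
    q₀ : V n
    q₀ = proj₁ X∩-U-point
    q₀∈L𝟐 : Level 𝟐 q₀
    q₀∈L𝟐 = proj₂ (proj₂ X∩-U-point)
    y : V n
    y = (𝟐 ·ᵥ x) +ᵥ (𝟐 ·ᵥ q₀)
    Xy : X y
    Xy = proj₂ (X≐Flat y) (Flat-affine₂₂ q ws (proj₁ (X≐Flat x) Xx) (proj₁ (X≐Flat q₀) (proj₁ (proj₂ X∩-U-point))))

  Level𝟐-dim : AffDim e (Level 𝟐)
  Level𝟐-dim = 𝟐 ·ᵥ p , vs , li , λ x → (λ z → z) , (λ z → z)

  #PrimitiveInSpan≤⅔ : ¬ (X ≐ Neg U) → Primitive (Span U) X → (X? : ∀ x → Dec (X x)) → 3 * # X? ≤ 2 * 3 ^ e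
  #PrimitiveInSpan≤⅔ _ X-prim@(build {X = X′} {d = d′} {e = e′} _ H-d _ _ U′-e′ U′⊆H U′⊊H half X′-prim A≐W∪X′ _ _ _) X? =
    *-cancelˡ-≤ 2 (begin
      2 * (3 * # X?)              ≡⟨ *-comm-middle (# X?) ⟩
      3 * (2 * # X?)              ≤⟨ *-monoʳ-≤ 3 (#build≤ H-d U′-e′ U′⊆H U′⊊H half X′? #X′≤ A≐W∪X′ X?) ⟩
      3 * (3 ^ d′ + 3 ^ e′)       ≡⟨ *-distribˡ-+ 3 (3 ^ d′) (3 ^ e′) ⟩
      3 * 3 ^ d′ + 3 ^ suc e′     ≤⟨ +-monoʳ-≤ (3 * 3 ^ d′) (^-monoʳ-≤ 3 e′<d′) ⟩
      3 * 3 ^ d′ + 3 ^ d′         ≤⟨ ≤-reflexive (four (3 ^ d′)) ⟩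
      2 * (2 * 3 ^ d′)            ≤⟨ *-monoʳ-≤ 2 (*-monoʳ-≤ 2 (^-monoʳ-≤ 3 (ambientDim≤ U-e X-prim))) ⟩
      2 * (2 * 3 ^ e)             ∎)
    where
    open Halves H-d U′-e′ U′⊆H U′⊊H half using () renaming (e<d to e′<d′)
    open ≤-Reasoning
    X′? : ∀ x → Dec (X′ x)
    X′? = Primitive? X′-prim
    #X′≤ : # X′? ≤ 3 ^ e′
    #X′≤ = #PrimitiveInSpan≤ U′-e′ X′-prim (#Primitive≤ X′-prim) X′?
    *-comm-middle : ∀ m → 2 * (3 * m) ≡ 3 * (2 * m)
    *-comm-middle = solve-∀
    four : ∀ m → 3 * m + m ≡ 2 * (2 * m)
    four = solve-∀
  #PrimitiveInSpan≤⅔ X≠-U (hyp {d = d′} _ X-d′ X⊆Span _) X? with ∃-Vec? n (λ y → Level? 𝟐 y ×-dec ¬? (X? y))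
  ... | no X⊇L𝟐 = ⊥-elim (X≠-U (λ y → Level𝟐⊆-U y ∘ X⊆L𝟐 y , (X⊇-U y)))
    where
    X⊆L𝟐 : X ⊆ Level 𝟐
    X⊆L𝟐 = AffineInSpan⊆Level𝟐 X-d′ X⊆Span
    X⊇-U : ∀ y → Neg U y → X y
    X⊇-U y -Uy with X? y
    ... | yes Xy = Xy
    ... | no ¬Xy = ⊥-elim (X⊇L𝟐 (y , -U⊆Level𝟐 y -Uy , ¬Xy))
  ... | yes (y , y∈L𝟐 , ¬Xy) = begin
    3 * # X?          ≡⟨ cong (3 *_) (#AffDim X-d′ X?) ⟩
    3 ^ suc d′        ≤⟨ ^-monoʳ-≤ 3 d′<e ⟩
    3 ^ e             ≤⟨ m≤m+n (3 ^ e) (3 ^ e + 0) ⟩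
    2 * 3 ^ e         ∎
    where
    open ≤-Reasoning
    d′<e : d′ < e
    d′<e = AffDim-mono-⊊ X-d′ Level𝟐-dim (AffineInSpan⊆Level𝟐 X-d′ X⊆Span) y y∈L𝟐 ¬Xy

module _ where
  open ≤-Reasoning

  gap-inequality : ∀ E w x b m P → 3 * (E + (w + w)) + P < 6 * b → b + m ≤ w + x → 3 * E + P + 6 * m < 6 * x
  gap-inequality E w x b m P big b+m≤ = +-cancelʳ-< (6 * w) (3 * E + P + 6 * m) (6 * x) (begin-strict
    3 * E + P + 6 * m + 6 * w        ≡⟨ regroup E w m P ⟩
    3 * (E + (w + w)) + P + 6 * m    <⟨ +-monoˡ-< (6 * m) big ⟩
    6 * b + 6 * m                    ≡⟨ *-distribˡ-+ 6 b m ⟨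
    6 * (b + m)                      ≤⟨ *-monoʳ-≤ 6 b+m≤ ⟩
    6 * (w + x)                      ≡⟨ trans (*-distribˡ-+ 6 w x) (+-comm (6 * w) (6 * x)) ⟩
    6 * x + 6 * w                    ∎)
    where
    regroup : ∀ E w m P → 3 * E + P + 6 * m + 6 * w ≡ 3 * (E + (w + w)) + P + 6 * m
    regroup = solve-∀

  slack : ∀ E P m x j → 3 * E + P + 6 * m < 6 * x → 6 * x ≤ 3 * E + j → P + 6 * m < j
  slack E P m x j gap 6x≤ = +-cancelˡ-< (3 * E) (P + 6 * m) j (begin-strict
    3 * E + (P + 6 * m)    ≡⟨ +-assoc (3 * E) P (6 * m) ⟨
    3 * E + P + 6 * m      <⟨ gap ⟩
    6 * x                  ≤⟨ 6x≤ ⟩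
    3 * E + j              ∎)

  6x≤9E : ∀ E x → x ≤ E → 6 * x ≤ 3 * E + 3 * E
  6x≤9E E x x≤E = ≤-trans (*-monoʳ-≤ 6 x≤E) (≤-reflexive (six E))
    where
    six : ∀ E → 6 * E ≡ 3 * E + 3 * E
    six = solve-∀

  6x≤4E : ∀ E x → 3 * x ≤ 2 * E → 6 * x ≤ 3 * E + E
  6x≤4E E x 3x≤2E = ≤-trans (≤-reflexive (double x)) (≤-trans (*-monoʳ-≤ 2 3x≤2E) (≤-reflexive (four E)))
    where
    double : ∀ x → 6 * x ≡ 2 * (3 * x)
    double = solve-∀
    four : ∀ E → 2 * (2 * E) ≡ 3 * E + E
    four = solve-∀

  half-of-codim1 : ∀ E w → 3 * E ≡ E + (w + w) → w ≡ E
  half-of-codim1 E w 3E≡ = *-cancelˡ-≡ w E 2 (+-cancelˡ-≡ E (2 * w) (2 * E) (begin-equality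
    E + 2 * w        ≡⟨ cong (E +_) (cong (w +_) (+-identityʳ w)) ⟩
    E + (w + w)      ≡⟨ 3E≡ ⟨
    3 * E            ≡⟨ cong (E +_) (cong (E +_) (+-identityʳ E)) ⟩
    E + (E + E)      ≡⟨ cong (E +_) (cong (E +_) (+-identityʳ E)) ⟨
    E + 2 * E        ∎))

  half-of-codim≥2 : ∀ E w D → 9 * E ≤ D → D ≡ E + (w + w) → 3 * E ≤ w
  half-of-codim≥2 E w D 9E≤D D≡ = *-cancelˡ-≤ 2 (+-cancelˡ-≤ E (2 * (3 * E)) (2 * w) (begin
    E + 2 * (3 * E)  ≤⟨ ≤-trans (≤-reflexive (seven E)) (m≤m+n (7 * E) (2 * E)) ⟩
    7 * E + 2 * E    ≡⟨ nine E ⟩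
    9 * E            ≤⟨ 9E≤D ⟩
    D                ≡⟨ D≡ ⟩
    E + (w + w)      ≡⟨ cong (E +_) (cong (w +_) (+-identityʳ w)) ⟨
    E + 2 * w        ∎))
    where
    seven : ∀ E → E + 2 * (3 * E) ≡ 7 * E
    seven = solve-∀
    nine : ∀ E → 7 * E + 2 * E ≡ 9 * E
    nine = solve-∀

  few-misses : ∀ E m → E + 6 * m < 3 * E → 2 * m + 1 ≤ E
  few-misses E m E+6m<3E = begin
    2 * m + 1      ≡⟨ +-comm (2 * m) 1 ⟩
    suc (2 * m)    ≤⟨ s≤s (*-monoˡ-≤ m (n≤1+n 2)) ⟩
    suc (3 * m)    ≤⟨ 3m<E ⟩
    E              ∎
    where
    3m<E : 3 * m < E
    3m<E = *-cancelˡ-< 2 (3 * m) E (+-cancelˡ-< E (2 * (3 * m)) (2 * E) (begin-strict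
      E + 2 * (3 * m)   ≡⟨ cong (E +_) (*-assoc 2 3 m) ⟨
      E + 6 * m         <⟨ E+6m<3E ⟩
      E + 2 * E         ∎))

  dense-if-few-misses : ∀ c mm m P → c + mm ≡ 3 * P → mm ≤ m → 2 * m + 1 ≤ P → 5 * (3 * P) + 3 ≤ 6 * c
  dense-if-few-misses c mm m P c+mm≡ mm≤m 2m+1≤P = +-cancelʳ-≤ (6 * mm) (5 * (3 * P) + 3) (6 * c) (begin
    5 * (3 * P) + 3 + 6 * mm    ≤⟨ +-monoʳ-≤ (5 * (3 * P) + 3) (*-monoʳ-≤ 6 mm≤m) ⟩
    5 * (3 * P) + 3 + 6 * m     ≡⟨ regroup P m ⟩
    15 * P + 3 * (2 * m + 1)    ≤⟨ +-monoʳ-≤ (15 * P) (*-monoʳ-≤ 3 2m+1≤P) ⟩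
    15 * P + 3 * P              ≡⟨ eighteen P ⟩
    6 * (3 * P)                 ≡⟨ cong (6 *_) c+mm≡ ⟨
    6 * (c + mm)                ≡⟨ *-distribˡ-+ 6 c mm ⟩
    6 * c + 6 * mm              ∎)
    where
    regroup : ∀ P m → 5 * (3 * P) + 3 + 6 * m ≡ 15 * P + 3 * (2 * m + 1)
    regroup = solve-∀
    eighteen : ∀ P → 15 * P + 3 * P ≡ 6 * (3 * P)
    eighteen = solve-∀

-- Dense flats by averaging

DenseFlat : ∀ {n} → (V n → Bool) → ℕ → Set
DenseFlat {n} B k = Σ (V n → Bool) λ E → AffDim k ⟦ E ⟧ × 5 * card E + 3 ≤ 6 * card (λ x → B x ∧ E x)

fewMisses⇒DenseFlat : ∀ {n k′} (B : V n → Bool) (x : V n) (ws : Vec (V n) (suc k′)) → LinIndep ws → ∀ m →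
  2 * m + 1 ≤ 3 ^ k′ → # (λ y → ¬? (B y Bool.≟ true) ×-dec Flat? x ws y) ≤ m → DenseFlat B (suc k′)
fewMisses⇒DenseFlat {n} {k′} B x ws li m 2m+1≤ #misses≤m =
  E , (x , ws , li , λ y → T-does (Flat? x ws y) , dec-true (Flat? x ws y)) , dense
  where
  E : V n → Bool
  E y = does (Flat? x ws y)
  misses : ℕ
  misses = # (λ y → ¬? (B y Bool.≟ true) ×-dec Flat? x ws y)
  T-does : ∀ {P : Set} (P? : Dec P) → does P? ≡ true → P
  T-does (yes p) _ = p
  #E : card E ≡ 3 ^ suc k′
  #E = trans (card≡Σᵥ E) (#Flat x ws li)
  split : ∀ b e → χ e ≡ χ (b ∧ e) + χ (not (does (b Bool.≟ true)) ∧ e)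
  split true e = sym (+-identityʳ (χ e))
  split false e = refl
  hits+misses : card (λ y → B y ∧ E y) + misses ≡ 3 * 3 ^ k′
  hits+misses = begin
    card (λ y → B y ∧ E y) + misses
      ≡⟨ cong (_+ misses) (card≡Σᵥ (λ y → B y ∧ E y)) ⟩
    Σᵥ n (λ y → χ (B y ∧ E y)) + misses
      ≡⟨ Σᵥ-distrib-+ n _ _ ⟨
    Σᵥ n (λ y → χ (B y ∧ E y) + χ (does (¬? (B y Bool.≟ true) ×-dec Flat? x ws y)))
      ≡⟨ Σᵥ-cong n (λ y → split (B y) (E y)) ⟨
    Σᵥ n (χ ∘ E)
      ≡⟨ card≡Σᵥ E ⟨
    card E
      ≡⟨ #E ⟩
    3 * 3 ^ k′ ∎
    where open ≡-Reasoning
  dense : 5 * card E + 3 ≤ 6 * card (λ y → B y ∧ E y)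
  dense = subst (λ c → 5 * c + 3 ≤ 6 * card (λ y → B y ∧ E y)) (sym #E)
    (dense-if-few-misses (card (λ y → B y ∧ E y)) misses m (3 ^ k′) hits+misses #misses≤m 2m+1≤)

lc-take : ∀ {n} k {r} (cs : V k) (vs : Vec (V n) (k + r)) → lc cs (take k vs) ≡ lc (cs ++ replicate r 𝟎) vs
lc-take zero [] vs = sym (lc-zeroˡ vs)
lc-take (suc k) (c ∷ cs) (v ∷ vs) = cong ((c ·ᵥ v) +ᵥ_) (lc-take k cs vs)

LinIndep-take : ∀ {n} k {r} (vs : Vec (V n) (k + r)) → LinIndep vs → LinIndep (take k vs)
LinIndep-take k {r} vs li cs lc≡0 = padded≡0⇒≡0 k cs (li (cs ++ replicate r 𝟎) (trans (sym (lc-take k cs vs)) lc≡0))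
  where
  padded≡0⇒≡0 : ∀ k (cs : V k) → cs ++ replicate r 𝟎 ≡ replicate (k + r) 𝟎 → cs ≡ replicate k 𝟎
  padded≡0⇒≡0 zero [] _ = refl
  padded≡0⇒≡0 (suc k) (c ∷ cs) e = cong₂ _∷_ (Vec.∷-injectiveˡ e) (padded≡0⇒≡0 k cs (Vec.∷-injectiveʳ e))

Flat-sym : ∀ {n k} (ws : Vec (V n) k) {x y} → Flat x ws y → Flat y ws x
Flat-sym ws {x} (cs , refl) = -ᵥ cs , (begin
  x                                        ≡⟨ coordinatewise x₀ ((x₀ ⊕ₜ x₁) ⊖ₜ x₁) [] (x ∷ lc cs ws ∷ []) ⟩
  (x +ᵥ lc cs ws) -ᵥ lc cs ws              ≡⟨ cong ((x +ᵥ lc cs ws) +ᵥ_) (lc-neg cs ws) ⟨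
  (x +ᵥ lc cs ws) +ᵥ lc (-ᵥ cs) ws         ∎)
  where open ≡-Reasoning

module Averaging {n k′ r} {U W : Pred n} (U-dim : AffDim (suc k′ + r) U)
                 (W+[U]⊆W : ∀ a b → W a → Diff U b → W (a +ᵥ b)) (W? : ∀ x → Dec (W x)) (B : V n → Bool) where

  open Levels U-dim using (p; vs; li; Level𝟎⊆[U])

  k : ℕ
  k = suc k′

  L : Vec (V n) k
  L = take k vs

  L-indep : LinIndep L
  L-indep = LinIndep-take k vs li

  B? : ∀ x → Dec (⟦ B ⟧ x)
  B? x = B x Bool.≟ true

  misses : V n → ℕ
  misses x = # (λ y → ¬? (B? y) ×-dec Flat? x L y)

  W∖B? : ∀ y → Dec (W y × ¬ ⟦ B ⟧ y)
  W∖B? y = W? y ×-dec ¬? (B? y)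

  Flat⊆W : ∀ {x y} → W x → Flat x L y → W y
  Flat⊆W {x} Wx (cs , refl) = W+[U]⊆W x (lc cs L) Wx
    (Level𝟎⊆[U] (lc cs L) (cs ++ replicate r 𝟎 ,
      trans (lc-take k cs vs) (sym (coordinatewise (const 𝟎 ⊗ₜ x₀ ⊕ₜ x₁) x₁ [] (p ∷ lc (cs ++ replicate r 𝟎) vs ∷ [])))))

  -- double counting of the pairs (x, y) with x ∈ W and y ∈ (x + ⟨L⟩) ∖ B
  Σmisses≤ : Σᵥ n (λ x → χ (does (W? x)) * misses x) ≤ 3 ^ k * # W∖B?
  Σmisses≤ = begin
    Σᵥ n (λ x → χ (does (W? x)) * misses x)
      ≡⟨ Σᵥ-cong n (λ x → sym (Σᵥ-distribˡ-* n (χ (does (W? x))) _)) ⟩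
    Σᵥ n (λ x → Σᵥ n (λ y → pair x y))
      ≡⟨ Σᵥ-comm n n pair ⟩
    Σᵥ n (λ y → Σᵥ n (λ x → pair x y))
      ≤⟨ Σᵥ-mono-≤ n column≤ ⟩
    Σᵥ n (λ y → 3 ^ k * χ (does (W∖B? y)))
      ≡⟨ Σᵥ-distribˡ-* n (3 ^ k) _ ⟩
    3 ^ k * # W∖B? ∎
    where
    open ≤-Reasoning
    pair : V n → V n → ℕ
    pair x y = χ (does (W? x)) * χ (does (¬? (B? y) ×-dec Flat? x L y))
    column≤ : ∀ y → Σᵥ n (λ x → pair x y) ≤ 3 ^ k * χ (does (W∖B? y))
    column≤ y with B y
    ... | true = ≤-trans (≤-reflexive (Σᵥ-zero n (λ x → *-zeroʳ (χ (does (W? x)))))) z≤n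
    ... | false with W? y
    ... | yes Wy = begin
      Σᵥ n (λ x → χ (does (W? x)) * χ (does (Flat? x L y)))
                                                 ≤⟨ Σᵥ-mono-≤ n (λ x → *-monoˡ-≤ _ (χ-does≤1 (W? x))) ⟩
      Σᵥ n (λ x → 1 * χ (does (Flat? x L y)))    ≤⟨ Σᵥ-mono-≤ n (λ x → ≤-trans (≤-reflexive (*-identityˡ _))
                                                        (χ-mono (Flat-sym L) (Flat? x L y) (Flat? y L x))) ⟩
      # Flat? y L                                ≡⟨ #Flat y L L-indep ⟩
      3 ^ k                                      ≡⟨ *-identityʳ (3 ^ k) ⟨
      3 ^ k * 1                                  ∎
    ... | no ¬Wy = ≤-trans (≤-reflexive (Σᵥ-zero n pair≡0)) z≤n
      where
      pair≡0 : ∀ x → χ (does (W? x)) * χ (does (Flat? x L y)) ≡ 0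
      pair≡0 x with W? x
      ... | no _ = refl
      ... | yes Wx = trans (*-identityˡ _) (χ-no (¬Wy ∘ Flat⊆W Wx) (Flat? x L y))

  averaging : (Σ (V n) λ x → W x × 2 * misses x + 1 ≤ 3 ^ k′) ⊎ (# W? ≤ 6 * # W∖B?)
  averaging with ∃-Vec? n (λ x → W? x ×-dec (2 * misses x + 1 ≤? 3 ^ k′))
  ... | yes (x , Wx , few) = inj₁ (x , Wx , few)
  ... | no ¬few = inj₂ (*-cancelʳ-≤ (# W?) (6 * # W∖B?) (3 ^ k′) {{m^n≢0 3 k′}} (begin
    # W? * P                                       ≡⟨ *-comm (# W?) P ⟩
    P * # W?                                       ≡⟨ Σᵥ-distribˡ-* n P _ ⟨
    Σᵥ n (λ x → P * χ (does (W? x)))               ≤⟨ Σᵥ-mono-≤ n manyMisses ⟩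
    Σᵥ n (λ x → 2 * (χ (does (W? x)) * misses x))  ≡⟨ Σᵥ-distribˡ-* n 2 _ ⟩
    2 * Σᵥ n (λ x → χ (does (W? x)) * misses x)    ≤⟨ *-monoʳ-≤ 2 Σmisses≤ ⟩
    2 * (3 * P * # W∖B?)                           ≡⟨ regroup P (# W∖B?) ⟩
    6 * # W∖B? * P                                 ∎))
    where
    open ≤-Reasoning
    P : ℕ
    P = 3 ^ k′
    manyMisses : ∀ x → P * χ (does (W? x)) ≤ 2 * (χ (does (W? x)) * misses x)
    manyMisses x with W? x
    ... | no _ = ≤-reflexive (*-zeroʳ P)
    ... | yes Wx = begin
      P * 1                  ≡⟨ *-identityʳ P ⟩
      P                      ≤⟨ s≤s⁻¹ (subst (suc P ≤_) (+-comm (2 * misses x) 1) (≰⇒> (λ few → ¬few (x , Wx , few)))) ⟩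
      2 * misses x           ≡⟨ cong (2 *_) (+-identityʳ (misses x)) ⟨
      2 * (1 * misses x)     ∎
    regroup : ∀ P m → 2 * (3 * P * m) ≡ 6 * m * P
    regroup = solve-∀

-- A flat of dimension dim U + 1 inside a half

LinIndep-∷ : ∀ {n k} {t : V n} {vs : Vec (V n) k} → ¬ (Σ (V k) λ cs → t ≡ lc cs vs) → LinIndep vs → LinIndep (t ∷ vs)
LinIndep-∷ {t = t} {vs} t∉⟨vs⟩ li (𝟎 ∷ cs) lc≡0 =
  cong (𝟎 ∷_) (li cs (trans (sym (+ᵥ-identityˡ (lc cs vs))) (trans (cong (_+ᵥ lc cs vs) (sym (·ᵥ-zeroˡ t))) lc≡0)))
LinIndep-∷ {t = t} {vs} t∉⟨vs⟩ li (𝟏 ∷ cs) lc≡0 = ⊥-elim (t∉⟨vs⟩ (-ᵥ cs , (begin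
  t                                        ≡⟨ coordinatewise x₀ ((const 𝟏 ⊗ₜ x₀ ⊕ₜ x₁) ⊖ₜ x₁) [] (t ∷ lc cs vs ∷ []) ⟩
  ((𝟏 ·ᵥ t) +ᵥ lc cs vs) -ᵥ lc cs vs       ≡⟨ cong₂ _+ᵥ_ lc≡0 (sym (lc-neg cs vs)) ⟩
  0ᵥ +ᵥ lc (-ᵥ cs) vs                      ≡⟨ +ᵥ-identityˡ _ ⟩
  lc (-ᵥ cs) vs                            ∎)))
  where open ≡-Reasoning
LinIndep-∷ {t = t} {vs} t∉⟨vs⟩ li (𝟐 ∷ cs) lc≡0 = ⊥-elim (t∉⟨vs⟩ (cs , (begin
  t                                        ≡⟨ coordinatewise x₀ (const 𝟐 ⊗ₜ (const 𝟐 ⊗ₜ x₀ ⊕ₜ x₁) ⊕ₜ x₁) [] (t ∷ lc cs vs ∷ []) ⟩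
  (𝟐 ·ᵥ ((𝟐 ·ᵥ t) +ᵥ lc cs vs)) +ᵥ lc cs vs ≡⟨ cong (λ z → (𝟐 ·ᵥ z) +ᵥ lc cs vs) lc≡0 ⟩
  (𝟐 ·ᵥ 0ᵥ) +ᵥ lc cs vs                    ≡⟨ trans (cong (_+ᵥ lc cs vs) (·ᵥ-zeroʳ 𝟐)) (+ᵥ-identityˡ _) ⟩
  lc cs vs                                 ∎)))
  where open ≡-Reasoning

AffDim-direction : ∀ {n d} {X : Pred n} (X-d : AffDim d X) {z y} → X z → X (z +ᵥ y) →
                   Σ (V d) λ cs → y ≡ lc cs (proj₁ (proj₂ X-d))
AffDim-direction (q , ws , _ , X≐Flat) {z} {y} Xz Xz+y
  with proj₁ (X≐Flat z) Xz | proj₁ (X≐Flat (z +ᵥ y)) Xz+y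
... | a , z≡ | b , z+y≡ = b -ᵥ a , (begin
  y                                        ≡⟨ +ᵥ‿-ᵥ-cancelˡ z y ⟨
  (z +ᵥ y) -ᵥ z                            ≡⟨ cong₂ _-ᵥ_ z+y≡ z≡ ⟩
  (q +ᵥ lc b ws) -ᵥ (q +ᵥ lc a ws)         ≡⟨ coordinatewise ((x₀ ⊕ₜ x₂) ⊖ₜ (x₀ ⊕ₜ x₁)) (x₂ ⊖ₜ x₁)
                                                             [] (q ∷ lc a ws ∷ lc b ws ∷ []) ⟩
  lc b ws -ᵥ lc a ws                       ≡⟨ cong (lc b ws +ᵥ_) (lc-neg a ws) ⟨
  lc b ws +ᵥ lc (-ᵥ a) ws                  ≡⟨ lc-+ b (-ᵥ a) ws ⟨
  lc (b -ᵥ a) ws                           ∎)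
  where open ≡-Reasoning

AffDim-translate : ∀ {n d} {X : Pred n} (X-d : AffDim d X) {z} → X z → ∀ cs → X (z +ᵥ lc cs (proj₁ (proj₂ X-d)))
AffDim-translate (q , ws , _ , X≐Flat) {z} Xz cs with proj₁ (X≐Flat z) Xz
... | a , refl = proj₂ (X≐Flat _) (a +ᵥ cs , trans (+ᵥ-assoc q (lc a ws) (lc cs ws)) (cong (q +ᵥ_) (sym (lc-+ a cs ws))))

AffDim-plane : ∀ {n d} {X : Pred n} → AffDim d X → ∀ {z a b} → X z → X (z +ᵥ a) → X (z +ᵥ b) →
               ∀ c₁ c₂ → X (z +ᵥ ((c₁ ·ᵥ a) +ᵥ (c₂ ·ᵥ b)))
AffDim-plane {n} {d} {X} X-d {z} {a} {b} Xz Xz+a Xz+b c₁ c₂ =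
  inPlane (AffDim-direction X-d Xz Xz+a) (AffDim-direction X-d Xz Xz+b)
  where
  ws : Vec (V n) d
  ws = proj₁ (proj₂ X-d)
  inPlane : Σ (V d) (λ ca → a ≡ lc ca ws) → Σ (V d) (λ cb → b ≡ lc cb ws) → X (z +ᵥ ((c₁ ·ᵥ a) +ᵥ (c₂ ·ᵥ b)))
  inPlane (ca , refl) (cb , refl) =
    subst (λ y → X (z +ᵥ y)) (trans (lc-+ (c₁ ·ᵥ ca) (c₂ ·ᵥ cb) ws) (cong₂ _+ᵥ_ (lc-· c₁ ca ws) (lc-· c₂ cb ws)))
      (AffDim-translate X-d Xz ((c₁ ·ᵥ ca) +ᵥ (c₂ ·ᵥ cb)))

-- up to a scalar, every nonzero direction of the plane F₃² is (1,0) or (c,1)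
data Direction : Set where
  horizontal : Direction
  slope : F3 → Direction

δ₁ δ₂ : Direction → F3
δ₁ horizontal = 𝟏
δ₁ (slope c) = c
δ₂ horizontal = 𝟎
δ₂ (slope c) = 𝟏

planeLine : (S : F3 → F3 → Set) → S 𝟏 𝟎 → (∀ c → S c 𝟏 ⊎ S (⊖ c) 𝟐) →
            Σ F3 λ o₁ → Σ F3 λ o₂ → Σ Direction λ δ → ∀ c → S (o₁ ⊕ (c ⊗ δ₁ δ)) (o₂ ⊕ (c ⊗ δ₂ δ))
planeLine S S₁₀ S₁or₂ with S₁or₂ 𝟎 | S₁or₂ 𝟏 | S₁or₂ 𝟐
... | inj₁ S₀₁ | inj₁ S₁₁ | inj₁ S₂₁ = 𝟎 , 𝟏 , horizontal , λ { 𝟎 → S₀₁ ; 𝟏 → S₁₁ ; 𝟐 → S₂₁ }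
... | inj₁ S₀₁ | inj₂ S₂₂ | _        = 𝟏 , 𝟎 , slope 𝟐 , λ { 𝟎 → S₁₀ ; 𝟏 → S₀₁ ; 𝟐 → S₂₂ }
... | _        | inj₁ S₁₁ | inj₂ S₁₂ = 𝟏 , 𝟎 , slope 𝟎 , λ { 𝟎 → S₁₀ ; 𝟏 → S₁₁ ; 𝟐 → S₁₂ }
... | inj₂ S₀₂ | _        | inj₁ S₂₁ = 𝟏 , 𝟎 , slope 𝟏 , λ { 𝟎 → S₁₀ ; 𝟏 → S₂₁ ; 𝟐 → S₀₂ }
... | inj₂ S₀₂ | inj₂ S₂₂ | inj₂ S₁₂ = 𝟎 , 𝟐 , horizontal , λ { 𝟎 → S₀₂ ; 𝟏 → S₁₂ ; 𝟐 → S₂₂ }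

plane-translate : ∀ {n} (p a b : V n) o₁ o₂ c d₁ d₂ →
  (p +ᵥ ((o₁ ·ᵥ a) +ᵥ (o₂ ·ᵥ b))) +ᵥ (c ·ᵥ ((d₁ ·ᵥ a) +ᵥ (d₂ ·ᵥ b))) ≡
  p +ᵥ (((o₁ ⊕ (c ⊗ d₁)) ·ᵥ a) +ᵥ ((o₂ ⊕ (c ⊗ d₂)) ·ᵥ b))
plane-translate p a b o₁ o₂ c d₁ d₂ =
  coordinatewise ((x₀ ⊕ₜ (σ₀ ⊗ₜ x₁ ⊕ₜ σ₁ ⊗ₜ x₂)) ⊕ₜ σ₂ ⊗ₜ (σ₃ ⊗ₜ x₁ ⊕ₜ σ₄ ⊗ₜ x₂))
                 (x₀ ⊕ₜ ((σ₀ ⊕ₛ σ₂ ⊗ₛ σ₃) ⊗ₜ x₁ ⊕ₜ (σ₁ ⊕ₛ σ₂ ⊗ₛ σ₄) ⊗ₜ x₂))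
                 (o₁ ∷ o₂ ∷ c ∷ d₁ ∷ d₂ ∷ []) (p ∷ a ∷ b ∷ [])
  where pattern σ₄ = svar (fsuc (fsuc (fsuc (fsuc fzero))))

module FlatsInHalf {n d e} {H U W : Pred n} (H-d : AffDim d H) (U-e : AffDim e U) (U⊆H : U ⊆ H)
                   (U⊊H : Σ (V n) λ h → H h × ¬ U h) (half : IsHalf H U W) where

  open Levels U-e using (p; vs; li; p∈U; U≐Flat; Level𝟎⊆[U])
  open Halves H-d U-e U⊆H U⊊H half

  _∈⟨vs⟩ : V n → Set
  t ∈⟨vs⟩ = Σ (V e) λ cs → t ≡ lc cs vs

  FlatInW : Set
  FlatInW = Σ (V n) λ o → Σ (V n) λ t → LinIndep (t ∷ vs) × (∀ y → Flat o (t ∷ vs) y → W y)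

  lineInW⇒FlatInW : ∀ o t → ¬ t ∈⟨vs⟩ → (∀ c → W (o +ᵥ (c ·ᵥ t))) → FlatInW
  lineInW⇒FlatInW o t t∉⟨vs⟩ lineInW = o , t , LinIndep-∷ t∉⟨vs⟩ li , λ where
    y (c ∷ cs , refl) → subst W (+ᵥ-assoc o (c ·ᵥ t) (lc cs vs))
      (W+[U]⊆W _ _ (lineInW c) (Level𝟎⊆[U] (lc cs vs) (cs , coordinatewise x₁ (const 𝟎 ⊗ₜ x₀ ⊕ₜ x₁) [] (p ∷ lc cs vs ∷ []))))

  Cosets : V n → Pred n
  Cosets a h = Σ F3 λ c → Flat (p +ᵥ (c ·ᵥ a)) vs h

  module Plane {w h : V n} (Ww : W w) (Hh : H h) (h∉Cosets : ¬ Cosets (w -ᵥ p) h) where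

    a b : V n
    a = w -ᵥ p
    b = h -ᵥ p

    P : F3 → F3 → V n
    P c₁ c₂ = p +ᵥ ((c₁ ·ᵥ a) +ᵥ (c₂ ·ᵥ b))

    P∈H : ∀ c₁ c₂ → H (P c₁ c₂)
    P∈H = AffDim-plane H-d (U⊆H p p∈U) (subst H (sym (+ᵥ-[-ᵥ]-cancel p w)) (W⊆H w Ww))
                                        (subst H (sym (+ᵥ-[-ᵥ]-cancel p h)) Hh)

    P₁₀≡w : P 𝟏 𝟎 ≡ w
    P₁₀≡w = coordinatewise (x₀ ⊕ₜ (const 𝟏 ⊗ₜ (x₁ ⊖ₜ x₀) ⊕ₜ const 𝟎 ⊗ₜ (x₂ ⊖ₜ x₀))) x₁ [] (p ∷ w ∷ h ∷ [])

    direction∉⟨vs⟩ : ∀ δ → ¬ ((δ₁ δ ·ᵥ a) +ᵥ (δ₂ δ ·ᵥ b)) ∈⟨vs⟩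
    direction∉⟨vs⟩ horizontal (cs , a≡) = U∩W=∅ w (proj₂ (U≐Flat w) (cs , (begin
      w                                       ≡⟨ P₁₀≡w ⟨
      p +ᵥ ((𝟏 ·ᵥ a) +ᵥ (𝟎 ·ᵥ b))              ≡⟨ cong (p +ᵥ_) a≡ ⟩
      p +ᵥ lc cs vs                           ∎))) Ww
      where open ≡-Reasoning
    direction∉⟨vs⟩ (slope c) (cs , ca+b≡) = h∉Cosets (⊖ c , cs , (begin
      h
        ≡⟨ coordinatewise x₂ ((x₀ ⊕ₜ (⊖ₛ σ₀) ⊗ₜ (x₁ ⊖ₜ x₀)) ⊕ₜ (σ₀ ⊗ₜ (x₁ ⊖ₜ x₀) ⊕ₜ const 𝟏 ⊗ₜ (x₂ ⊖ₜ x₀)))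
                          (c ∷ []) (p ∷ w ∷ h ∷ []) ⟩
      (p +ᵥ ((⊖ c) ·ᵥ a)) +ᵥ ((c ·ᵥ a) +ᵥ (𝟏 ·ᵥ b))
        ≡⟨ cong ((p +ᵥ ((⊖ c) ·ᵥ a)) +ᵥ_) ca+b≡ ⟩
      (p +ᵥ ((⊖ c) ·ᵥ a)) +ᵥ lc cs vs ∎))
      where open ≡-Reasoning

    W-or-reflected : ∀ c → W (P c 𝟏) ⊎ W (P (⊖ c) 𝟐)
    W-or-reflected c = classify (proj₁ (H≐U⊎W⊎-U-W (P c 𝟏)) (P∈H c 𝟏))
      where
      reflect-P : reflect (P c 𝟏) ≡ P (⊖ c) 𝟐
      reflect-P = coordinatewise ((⊖ₜ x₀) ⊖ₜ (x₀ ⊕ₜ (σ₀ ⊗ₜ x₁ ⊕ₜ const 𝟏 ⊗ₜ x₂)))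
                                 (x₀ ⊕ₜ ((⊖ₛ σ₀) ⊗ₜ x₁ ⊕ₜ const 𝟐 ⊗ₜ x₂)) (c ∷ []) (p ∷ a ∷ b ∷ [])
      classify : U (P c 𝟏) ⊎ (W (P c 𝟏) ⊎ -U-W (P c 𝟏)) → W (P c 𝟏) ⊎ W (P (⊖ c) 𝟐)
      classify (inj₁ UP) = ⊥-elim (direction∉⟨vs⟩ (slope c) (AffDim-direction U-e p∈U UP))
      classify (inj₂ (inj₁ WP)) = inj₁ WP
      classify (inj₂ (inj₂ -U-WP)) = inj₂ (subst W reflect-P (-U-W⊆W∘reflect (P c 𝟏) -U-WP))

    flatInW : FlatInW
    flatInW = fromLine (planeLine (λ c₁ c₂ → W (P c₁ c₂)) (subst W (sym P₁₀≡w) Ww) W-or-reflected)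
      where
      fromLine : (Σ F3 λ o₁ → Σ F3 λ o₂ → Σ Direction λ δ →
                    ∀ c → W (P (o₁ ⊕ (c ⊗ δ₁ δ)) (o₂ ⊕ (c ⊗ δ₂ δ)))) → FlatInW
      fromLine (o₁ , o₂ , δ , lineInW) = lineInW⇒FlatInW (P o₁ o₂) ((δ₁ δ ·ᵥ a) +ᵥ (δ₂ δ ·ᵥ b)) (direction∉⟨vs⟩ δ)
        (λ c → subst W (sym (plane-translate p a b o₁ o₂ c (δ₁ δ) (δ₂ δ))) (lineInW c))

  Cosets? : ∀ a h → Dec (Cosets a h)
  Cosets? a h = Fin.any? λ c → Flat? (p +ᵥ (c ·ᵥ a)) vs h

  flatInW-exists : suc e < d → FlatInW
  flatInW-exists e+1<d with ∃-Vec? n W?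
  ... | no W=∅ = ⊥-elim (<-irrefl (sym (3^-injective d e (trans #H≡ W=∅⇒))) e<d)
    where
    W=∅⇒ : 3 ^ e + (# W? + # W?) ≡ 3 ^ e
    W=∅⇒ rewrite Σᵥ-zero n (λ x → χ-no (λ Wx → W=∅ (x , Wx)) (W? x)) = +-identityʳ (3 ^ e)
  ... | yes (w , Ww) with ∃-Vec? n (λ h → H? h ×-dec ¬? (Cosets? (w -ᵥ p) h))
  ... | yes (h , Hh , h∉) = Plane.flatInW Ww Hh h∉
  ... | no H⊆Cosets = ⊥-elim (<⇒≱ e+1<d (3^-reflects-≤ d (suc e)
    (subst (_≤ 3 ^ suc e) (#AffDim H-d H?) (#-⋃₃Flat≤ (λ c → p +ᵥ (c ·ᵥ (w -ᵥ p))) vs li H? H⊆Cosets′))))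
    where
    H⊆Cosets′ : ∀ h → H h → Cosets (w -ᵥ p) h
    H⊆Cosets′ h Hh with Cosets? (w -ᵥ p) h
    ... | yes h∈ = h∈
    ... | no h∉ = ⊥-elim (H⊆Cosets (h , Hh , h∉))

module DenseFlatInPrimitive {n d e} {H U W X : Pred n} (B : V n → Bool) (1+d≡n : suc d ≡ n)
  (H-d : AffDim d H) (U-e : AffDim e U) (U⊆H : U ⊆ H) (U⊊H : Σ (V n) λ h → H h × ¬ U h) (half : IsHalf H U W)
  (X-prim : Primitive (Span U) X) (B⊆W∪X : ∀ x → ⟦ B ⟧ x → W x ⊎ X x)
  (X∩[U]=∅ : ∀ x → X x → Diff U x → ⊥) (codim : (2 + e ≤ d) ⊎ ¬ (X ≐ Neg U))
  (X∩-U-spans : AffHull (X ∩ Neg U) ≐ Neg U) where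

  open Levels U-e using (vs)
  open Halves H-d U-e U⊆H U⊊H half using (W?; W+[U]⊆W; #H≡; e<d)
  open FlatsInHalf H-d U-e U⊆H U⊊H half using (flatInW-exists)

  E : ℕ
  E = 3 ^ e

  X? : ∀ x → Dec (X x)
  X? = Primitive? X-prim

  #X≤E : # X? ≤ E
  #X≤E = #PrimitiveInSpan≤ U-e X-prim (#Primitive≤ X-prim) X?

  B? : ∀ x → Dec (⟦ B ⟧ x)
  B? x = B x Bool.≟ true

  W∖B? : ∀ x → Dec (W x × ¬ ⟦ B ⟧ x)
  W∖B? x = W? x ×-dec ¬? (B? x)

  m : ℕ
  m = # W∖B?

  #B+m≤#W+#X : # B? + m ≤ # W? + # X?
  #B+m≤#W+#X = subst₂ _≤_ (Σᵥ-distrib-+ n _ _) (Σᵥ-distrib-+ n _ _) (Σᵥ-mono-≤ n χ≤)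
    where
    χ≤ : ∀ x → χ (does (B? x)) + χ (does (W∖B? x)) ≤ χ (does (W? x)) + χ (does (X? x))
    χ≤ x with B? x | W? x
    ... | yes _ | yes _ = s≤s z≤n
    ... | yes Bx | no ¬Wx = ≤-reflexive (sym (χ-yes ([ ⊥-elim ∘ ¬Wx , (λ Xx → Xx) ]′ (B⊆W∪X x Bx)) (X? x)))
    ... | no _ | yes _ = s≤s z≤n
    ... | no _ | no _ = z≤n

  gap : ∀ k′ → 3 ^ n + 3 ^ k′ < 6 * card B → 3 * E + 3 ^ k′ + 6 * m < 6 * # X?
  gap k′ big = gap-inequality E (# W?) (# X?) (# B?) m (3 ^ k′)
    (subst₂ (λ N b → N + 3 ^ k′ < 6 * b) (trans (cong (3 ^_) (sym 1+d≡n)) (cong (3 *_) #H≡)) (card≡# B) big)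
    #B+m≤#W+#X

  viaAveraging : ∀ k′ → suc k′ ≤ e → 6 * m < # W? → DenseFlat B (suc k′)
  viaAveraging k′ 1+k′≤e 6m<#W = fromSplit (m≤n⇒∃[o]m+o≡n 1+k′≤e)
    where
    fromSplit : Σ ℕ (λ r → suc k′ + r ≡ e) → DenseFlat B (suc k′)
    fromSplit (r , 1+k′+r≡e) = [ goodTranslate , (λ #W≤6m → ⊥-elim (<⇒≱ 6m<#W #W≤6m)) ]′ averaging
      where
      open Averaging {k′ = k′} {r = r} (subst (λ j → AffDim j U) (sym 1+k′+r≡e) U-e) W+[U]⊆W W? B
      goodTranslate : (Σ (V n) λ x → W x × 2 * misses x + 1 ≤ 3 ^ k′) → DenseFlat B (suc k′)
      goodTranslate (x , _ , few) = fewMisses⇒DenseFlat B x L L-indep (misses x) few ≤-refl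

  viaFlatInW : suc e < d → 2 * m + 1 ≤ E → DenseFlat B (suc e)
  viaFlatInW 1+e<d 2m+1≤E = fromFlat (flatInW-exists 1+e<d)
    where
    fromFlat : FlatsInHalf.FlatInW H-d U-e U⊆H U⊊H half → DenseFlat B (suc e)
    fromFlat (o , t , indep , flat⊆W) = fewMisses⇒DenseFlat B o (t ∷ vs) indep m 2m+1≤E
      (#-mono-⊆ (λ y → ¬? (B? y) ×-dec Flat? o (t ∷ vs) y) W∖B? (λ y → λ { (¬By , y∈flat) → flat⊆W y y∈flat , ¬By }))

  codim-one : suc e ≡ d → ∀ k′ → 3 ^ n + 3 ^ k′ < 6 * card B → DenseFlat B (suc k′)
  codim-one 1+e≡d k′ big = viaAveraging k′ k′<e (subst (6 * m <_) (sym #W≡E) 6m<E)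
    where
    X≠-U : ¬ (X ≐ Neg U)
    X≠-U = [ (λ 2+e≤d → ⊥-elim (1+n≰n (subst (2 + e ≤_) (sym 1+e≡d) 2+e≤d))) , (λ X≠-U → X≠-U) ]′ codim
    P+6m<E : 3 ^ k′ + 6 * m < E
    P+6m<E = slack E (3 ^ k′) m (# X?) E (gap k′ big)
      (6x≤4E E (# X?) (#PrimitiveInSpan≤⅔ U-e X∩[U]=∅ X∩-U-spans X≠-U X-prim X?))
    #W≡E : # W? ≡ E
    #W≡E = half-of-codim1 E (# W?) (trans (cong (3 ^_) 1+e≡d) #H≡)
    6m<E : 6 * m < E
    6m<E = ≤-trans (s≤s (m≤n+m (6 * m) (3 ^ k′))) P+6m<E
    k′<e : suc k′ ≤ e
    k′<e = 3^-reflects-< k′ e (≤-trans (s≤s (m≤m+n (3 ^ k′) (6 * m))) P+6m<E)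

  codim≥2 : suc e < d → ∀ k′ → 3 ^ n + 3 ^ k′ < 6 * card B → DenseFlat B (suc k′)
  codim≥2 1+e<d k′ big = byDim (suc k′ ≤? e)
    where
    P+6m<3E : 3 ^ k′ + 6 * m < 3 * E
    P+6m<3E = slack E (3 ^ k′) m (# X?) (3 * E) (gap k′ big) (6x≤9E E (# X?) #X≤E)
    3E≤#W : 3 * E ≤ # W?
    3E≤#W = half-of-codim≥2 E (# W?) (3 ^ d) (subst (_≤ 3 ^ d) (nine E) (^-monoʳ-≤ 3 1+e<d)) #H≡
      where
      nine : ∀ E → 3 * (3 * E) ≡ 9 * E
      nine = solve-∀
    byDim : Dec (suc k′ ≤ e) → DenseFlat B (suc k′)
    byDim (yes 1+k′≤e) = viaAveraging k′ 1+k′≤e (≤-trans (s≤s (m≤n+m (6 * m) (3 ^ k′))) (≤-trans P+6m<3E 3E≤#W))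
    byDim (no 1+k′≰e) = subst (λ j → DenseFlat B (suc j)) (sym k′≡e)
      (viaFlatInW 1+e<d (few-misses E m (subst (λ j → 3 ^ j + 6 * m < 3 * E) k′≡e P+6m<3E)))
      where
      k′≡e : k′ ≡ e
      k′≡e = ≤-antisym (s≤s⁻¹ (3^-reflects-< k′ (suc e) (≤-trans (s≤s (m≤m+n (3 ^ k′) (6 * m))) P+6m<3E)))
                       (s≤s⁻¹ (≰⇒> 1+k′≰e))

  denseFlat : ∀ k′ → 3 ^ n + 3 ^ k′ < 6 * card B → DenseFlat B (suc k′)
  denseFlat = [ codim≥2 , codim-one ]′ (m≤n⇒m<n∨m≡n e<d)

lemma2p7 : (n : ℕ) (B : V n → Bool) (k : ℕ) →
  Subprimitive ⟦ B ⟧ →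
  (∀ (d : ℕ) (H : Pred n) → suc d ≡ n → AffDim d H → ¬ (⟦ B ⟧ ⊆ H)) →
  1 ≤ k →
  3 ^ n + 3 ^ (k ∸ 1) < 6 * card B →
  Σ (V n → Bool) λ E → AffDim k ⟦ E ⟧ ×
    5 * card E + 3 ≤ 6 * card (λ x → B x ∧ E x)
lemma2p7 n B zero _ _ () _
lemma2p7 n B (suc k′) (A , hyp {d = d} S-d A-d _ _ , B⊆A) B-spans _ _ =
  ⊥-elim (B-spans d A (dim-Full (proj₁ S-d)) A-d B⊆A)
lemma2p7 n B (suc k′) (A , build S-d H-d _ _ U-e U⊆H U⊊H half X-prim A≐W∪X X∩[U]=∅ codim X∩-U-spans , B⊆A) _ _ big =
  DenseFlatInPrimitive.denseFlat B (dim-Full (proj₁ S-d)) H-d U-e U⊆H U⊊H half X-prim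
    (λ x Bx → proj₁ (A≐W∪X x) (B⊆A x Bx)) X∩[U]=∅ codim X∩-U-spans k′ big
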